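{- Let $n\ge 1$, let $G$ be a finite $n$-regular bipartite graph on $N$ vertices, and let $H$ be any finite graph (loops allowed). Then $$\frac{\log\eta(H)}{2} \leq \frac{\log|\mathrm{Hom}(G,H)|}{N} \leq \frac{\log\eta(H)}{2} + \frac{|V(H)|}{2n},$$ where $\log$ is the base-$2$ logarithm.
   Context: Graphs $H$ are finite, undirected, without multiple edges, and may have loops (a vertex $i$ with a loop satisfies $i\sim i$). $\mathrm{Hom}(G,H)=\{f:V(G)\to V(H) : u\sim v \Rightarrow f(u)\sim f(v)\}$. Define $\eta(H)=\max\{|A||B| : A,B\subseteq V(H),\ i\sim j \text{ for all } i\in A, j\in B\}$. -}

module Defs where

open import Data.Nat using (ℕ; zero; suc; _≤_)
open import Data.Nat.Base using (_*_)
open import Data.Bool using (Bool; true; false; not; _∨_; if_then_else_)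
open import Data.Fin using (Fin; zero; suc)
open import Data.Fin.Subset using (Subset; _∈_; ∣_∣; inside; outside)
open import Data.List using (List; []; _∷_; [_]; map; concatMap; length; filterᵇ; allFin)
open import Data.Bool.ListAction using (and)
open import Data.Vec using (tabulate)
open import Data.Product using (Σ; _×_)
open import Relation.Binary.PropositionalEquality using (_≡_)

record Graph : Set where
  field
    size : ℕ
    adj  : Fin size → Fin size → Bool
    sym  : ∀ i j → adj i j ≡ adj j i
open Graph public

IsSimple : Graph → Set
IsSimple G = ∀ i → adj G i i ≡ false

IsBipartite : Graph → Set
IsBipartite G = Σ (Fin (size G) → Bool) λ c →
  ∀ u v → adj G u v ≡ true → c u ≡ not (c v)

nbhd : (G : Graph) → Fin (size G) → Subset (size G)
nbhd G v = tabulate λ j → if adj G v j then inside else outside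

degree : (G : Graph) → Fin (size G) → ℕ
degree G v = ∣ nbhd G v ∣

IsRegular : ℕ → Graph → Set
IsRegular n G = ∀ v → degree G v ≡ n

-- enumeration of all functions Fin N → Fin k (each exactly once, up to pointwise equality)
cons : ∀ {N k} → Fin k → (Fin N → Fin k) → Fin (suc N) → Fin k
cons a f zero    = a
cons a f (suc i) = f i

allFuns : (N k : ℕ) → List (Fin N → Fin k)
allFuns zero    k = [ (λ ()) ]
allFuns (suc N) k = concatMap (λ f → map (λ a → cons a f) (allFin k)) (allFuns N k)

isHomᵇ : (G H : Graph) → (Fin (size G) → Fin (size H)) → Bool
isHomᵇ G H f = and (map (λ u → and (map (λ v → not (adj G u v) ∨ adj H (f u) (f v)) (allFin (size G)))) (allFin (size G)))

homCount : Graph → Graph → ℕ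
homCount G H = length (filterᵇ (isHomᵇ G H) (allFuns (size G) (size H)))

Complete : (H : Graph) → Subset (size H) → Subset (size H) → Set
Complete H A B = ∀ i j → i ∈ A → j ∈ B → adj H i j ≡ true

IsEta : Graph → ℕ → Set
IsEta H e =
  (Σ (Subset (size H)) λ A → Σ (Subset (size H)) λ B → Complete H A B × ∣ A ∣ * ∣ B ∣ ≡ e)
  × (∀ A B → Complete H A B → ∣ A ∣ * ∣ B ∣ ≤ e)

module Submission where

-- If A,B ⊆ V(H) are completely joined, every map sending the two colour
-- classes of G into A and B respectively is a homomorphism; counting these maps for
-- (A,B) and (B,A) gives |A|^a|B|^b · |B|^a|A|^b = (|A||B|)^N ≤ hom².
--
-- This is the Galvin–Tetali bound hom(G,H)^(2n) ≤ hom(K_{n,n},H)^N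
-- combined with hom(K_{n,n},H) ≤ 2^k e^n.  Homomorphisms are counted as the sum over
-- all assignments x : V(G) → V(H) of a product of edge tests.  Two generalised
-- Hölder inequalities (iterated-holder) integrate out the coordinates of one colour
-- class and then of the other: a single integration step is the p-fold Hölder
-- inequality (holder-step), proved from AM–GM; the exponent p is the number of factors
-- depending on the coordinate, i.e. 1 and then n (regularity).  What remains is, for
-- every white vertex v, the "star sum" of its edge tests, which is bounded by 2^k e^n
-- by grouping assignments according to the image of the neighbourhood of v
-- (StarBound).  Running the argument for both colourings and multiplying gives the
-- claim; an empty H is handled separately.

open import Defs hiding (sym)
open import Data.Nat using (ℕ; zero; suc; _+_; _*_; _^_; _≤_; _<_; z≤n; s≤s; NonZero)
open import Data.Nat.Base using (>-nonZero; ≢-nonZero)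
open import Data.Nat.Properties
open import Data.Bool using (Bool; true; false; not; _∨_; _∧_; if_then_else_)
open import Data.Bool.Properties using (not-¬; not-injective; ∧-zeroʳ; ∧-identityʳ; ∨-identityʳ; ∧-conicalˡ; ∧-conicalʳ; ∨-conicalˡ; ∨-conicalʳ)
open import Data.Fin using (Fin; zero; suc)
open import Data.List using (List; []; _∷_; map; concatMap; length; filterᵇ; allFin; _++_; tabulate)
open import Data.List.Relation.Unary.Any using (here; there)
import Data.List.Membership.Propositional as LM
open import Data.List.Membership.Propositional.Properties using (∈-allFin)
open import Data.Bool.ListAction using (and)
open import Data.Vec using (lookup) renaming (tabulate to vtab; _∷_ to _∷ᵥ_; [] to []ᵥ)
open import Data.Vec.Properties using (lookup∘tabulate; []=⇒lookup; lookup⇒[]=)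
open import Data.Fin.Subset using (Subset; ∣_∣; inside; outside) renaming (_∈_ to _∈ₛ_)
open import Data.Product using (Σ; _×_; _,_; proj₁; proj₂)
open import Data.Sum using (inj₁; inj₂)
open import Relation.Binary.PropositionalEquality
open import Data.Empty using (⊥; ⊥-elim)
open import Data.Nat.Tactic.RingSolver using (solve-∀)

ind : Bool → ℕ
ind true = 1
ind false = 0

ind≤1 : ∀ b → ind b ≤ 1
ind≤1 true = s≤s z≤n
ind≤1 false = z≤n

ΣF : (n : ℕ) → (Fin n → ℕ) → ℕ
ΣF zero f = 0
ΣF (suc n) f = f zero + ΣF n (λ i → f (suc i))

ΠF : (n : ℕ) → (Fin n → ℕ) → ℕ
ΠF zero f = 1
ΠF (suc n) f = f zero * ΠF n (λ i → f (suc i))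

ΣF-cong : ∀ n {f g : Fin n → ℕ} → (∀ i → f i ≡ g i) → ΣF n f ≡ ΣF n g
ΣF-cong zero eq = refl
ΣF-cong (suc n) eq = cong₂ _+_ (eq zero) (ΣF-cong n (λ i → eq (suc i)))

ΠF-cong : ∀ n {f g : Fin n → ℕ} → (∀ i → f i ≡ g i) → ΠF n f ≡ ΠF n g
ΠF-cong zero eq = refl
ΠF-cong (suc n) eq = cong₂ _*_ (eq zero) (ΠF-cong n (λ i → eq (suc i)))

ΠF-mono : ∀ n {f g : Fin n → ℕ} → (∀ i → f i ≤ g i) → ΠF n f ≤ ΠF n g
ΠF-mono zero le = ≤-refl
ΠF-mono (suc n) le = *-mono-≤ (le zero) (ΠF-mono n (λ i → le (suc i)))

ΣF-+ : ∀ n (f g : Fin n → ℕ) → ΣF n (λ i → f i + g i) ≡ ΣF n f + ΣF n g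
ΣF-+ zero f g = refl
ΣF-+ (suc n) f g rewrite ΣF-+ n (λ i → f (suc i)) (λ i → g (suc i)) =
  lem (f zero) (g zero) (ΣF n (λ i → f (suc i))) (ΣF n (λ i → g (suc i)))
  where lem : ∀ a b c d → a + b + (c + d) ≡ a + c + (b + d)
        lem = solve-∀

ΣF-*ˡ : ∀ n c (f : Fin n → ℕ) → c * ΣF n f ≡ ΣF n (λ i → c * f i)
ΣF-*ˡ zero c f = *-zeroʳ c
ΣF-*ˡ (suc n) c f rewrite sym (ΣF-*ˡ n c (λ i → f (suc i))) = *-distribˡ-+ c (f zero) _

ΣF-const : ∀ n c → ΣF n (λ _ → c) ≡ n * c
ΣF-const zero c = refl
ΣF-const (suc n) c = cong (c +_) (ΣF-const n c)

ΠF-* : ∀ n (f g : Fin n → ℕ) → ΠF n (λ i → f i * g i) ≡ ΠF n f * ΠF n g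
ΠF-* zero f g = refl
ΠF-* (suc n) f g rewrite ΠF-* n (λ i → f (suc i)) (λ i → g (suc i)) =
  lem (f zero) (g zero) (ΠF n (λ i → f (suc i))) (ΠF n (λ i → g (suc i)))
  where lem : ∀ a b c d → a * b * (c * d) ≡ a * c * (b * d)
        lem = solve-∀

ΠF-const : ∀ n c → ΠF n (λ _ → c) ≡ c ^ n
ΠF-const zero c = refl
ΠF-const (suc n) c = cong (c *_) (ΠF-const n c)

^-distrib-* : ∀ a b p → (a * b) ^ p ≡ a ^ p * b ^ p
^-distrib-* a b zero = refl
^-distrib-* a b (suc p) rewrite ^-distrib-* a b p = lem a b (a ^ p) (b ^ p)
  where lem : ∀ a b c d → a * b * (c * d) ≡ a * c * (b * d)
        lem = solve-∀

ΠF-^ : ∀ n (f : Fin n → ℕ) p → ΠF n (λ i → f i ^ p) ≡ ΠF n f ^ p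
ΠF-^ zero f p = sym (^-zeroˡ p)
ΠF-^ (suc n) f p rewrite ΠF-^ n (λ i → f (suc i)) p = sym (^-distrib-* (f zero) _ p)

ΠF-if1 : ∀ n (b : Fin n → Bool) c → ΠF n (λ i → if b i then c else 1) ≡ c ^ ΣF n (λ i → ind (b i))
ΠF-if1 zero b c = refl
ΠF-if1 (suc n) b c with b zero
... | true rewrite ΠF-if1 n (λ i → b (suc i)) c = refl
... | false rewrite ΠF-if1 n (λ i → b (suc i)) c = +-identityʳ _

ΣF-split : ∀ n (b : Fin n → Bool) → ΣF n (λ i → ind (b i)) + ΣF n (λ i → ind (not (b i))) ≡ n
ΣF-split zero b = refl
ΣF-split (suc n) b with b zero
... | true = cong suc (ΣF-split n (λ i → b (suc i)))
... | false = trans (+-suc _ _) (cong suc (ΣF-split n (λ i → b (suc i))))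

ΣF-swap : ∀ n m (f : Fin n → Fin m → ℕ) → ΣF n (λ i → ΣF m (λ j → f i j)) ≡ ΣF m (λ j → ΣF n (λ i → f i j))
ΣF-swap zero m f = sym (trans (ΣF-cong m (λ j → refl)) (trans (ΣF-const m 0) (*-zeroʳ m)))
ΣF-swap (suc n) m f = trans (cong (ΣF m (f zero) +_) (ΣF-swap n m (λ i → f (suc i))))
                             (sym (ΣF-+ m (f zero) (λ j → ΣF n (λ i → f (suc i) j))))

ΠF-swap : ∀ n m (f : Fin n → Fin m → ℕ) → ΠF n (λ i → ΠF m (λ j → f i j)) ≡ ΠF m (λ j → ΠF n (λ i → f i j))
ΠF-swap zero m f = sym (trans (ΠF-const m 1) (^-zeroˡ m))
ΠF-swap (suc n) m f = trans (cong (ΠF m (f zero) *_) (ΠF-swap n m (λ i → f (suc i))))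
                             (sym (ΠF-* m (f zero) (λ j → ΠF n (λ i → f (suc i) j))))

eqᵇ : ∀ {n} → Fin n → Fin n → Bool
eqᵇ zero zero = true
eqᵇ zero (suc _) = false
eqᵇ (suc _) zero = false
eqᵇ (suc i) (suc j) = eqᵇ i j

eqᵇ-refl : ∀ {n} (i : Fin n) → eqᵇ i i ≡ true
eqᵇ-refl zero = refl
eqᵇ-refl (suc i) = eqᵇ-refl i

eqᵇ-sound : ∀ {n} (i j : Fin n) → eqᵇ i j ≡ true → i ≡ j
eqᵇ-sound zero zero _ = refl
eqᵇ-sound (suc i) (suc j) e = cong suc (eqᵇ-sound i j e)

eqᵇ-sym : ∀ {n} (i j : Fin n) → eqᵇ i j ≡ eqᵇ j i
eqᵇ-sym zero zero = refl
eqᵇ-sym zero (suc j) = refl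
eqᵇ-sym (suc i) zero = refl
eqᵇ-sym (suc i) (suc j) = eqᵇ-sym i j

ΣF-eqᵇ : ∀ n (v : Fin n) → ΣF n (λ j → ind (eqᵇ j v)) ≡ 1
ΣF-eqᵇ (suc n) zero = cong suc (trans (ΣF-cong n (λ i → refl)) (trans (ΣF-const n 0) (*-zeroʳ n)))
ΣF-eqᵇ (suc n) (suc v) = ΣF-eqᵇ n v

sumL : {A : Set} → List A → (A → ℕ) → ℕ
sumL [] f = 0
sumL (x ∷ xs) f = f x + sumL xs f

sumL-cong : {A : Set} (l : List A) {f g : A → ℕ} → (∀ x → f x ≡ g x) → sumL l f ≡ sumL l g
sumL-cong [] eq = refl
sumL-cong (x ∷ l) eq = cong₂ _+_ (eq x) (sumL-cong l eq)

sumL-mono : {A : Set} (l : List A) {f g : A → ℕ} → (∀ x → f x ≤ g x) → sumL l f ≤ sumL l g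
sumL-mono [] le = z≤n
sumL-mono (x ∷ l) le = +-mono-≤ (le x) (sumL-mono l le)

sumL-+ : {A : Set} (l : List A) (f g : A → ℕ) → sumL l (λ x → f x + g x) ≡ sumL l f + sumL l g
sumL-+ [] f g = refl
sumL-+ (x ∷ l) f g rewrite sumL-+ l f g = lem (f x) (g x) (sumL l f) (sumL l g)
  where lem : ∀ a b c d → a + b + (c + d) ≡ a + c + (b + d)
        lem = solve-∀

sumL-*ˡ : {A : Set} (l : List A) (c : ℕ) (f : A → ℕ) → c * sumL l f ≡ sumL l (λ x → c * f x)
sumL-*ˡ [] c f = *-zeroʳ c
sumL-*ˡ (x ∷ l) c f rewrite sym (sumL-*ˡ l c f) = *-distribˡ-+ c (f x) _

sumL-*ʳ : {A : Set} (l : List A) (f : A → ℕ) (c : ℕ) → sumL l f * c ≡ sumL l (λ x → f x * c)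
sumL-*ʳ l f c = trans (*-comm _ c) (trans (sumL-*ˡ l c f) (sumL-cong l (λ x → *-comm c (f x))))

sumL-const : {A : Set} (l : List A) (c : ℕ) → sumL l (λ _ → c) ≡ length l * c
sumL-const [] c = refl
sumL-const (x ∷ l) c = cong (c +_) (sumL-const l c)

sumL-map : {A B : Set} (h : A → B) (l : List A) (f : B → ℕ) → sumL (map h l) f ≡ sumL l (λ x → f (h x))
sumL-map h [] f = refl
sumL-map h (x ∷ l) f = cong (f (h x) +_) (sumL-map h l f)

sumL-++ : {A : Set} (l l' : List A) (f : A → ℕ) → sumL (l ++ l') f ≡ sumL l f + sumL l' f
sumL-++ [] l' f = refl
sumL-++ (x ∷ l) l' f rewrite sumL-++ l l' f = sym (+-assoc (f x) _ _)

sumL-concatMap : {A B : Set} (g : A → List B) (l : List A) (f : B → ℕ) →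
  sumL (concatMap g l) f ≡ sumL l (λ x → sumL (g x) f)
sumL-concatMap g [] f = refl
sumL-concatMap g (x ∷ l) f = trans (sumL-++ (g x) (concatMap g l) f) (cong (sumL (g x) f +_) (sumL-concatMap g l f))

sumL-tab : {B : Set} (n : ℕ) (h : Fin n → B) (f : B → ℕ) → sumL (tabulate h) f ≡ ΣF n (λ i → f (h i))
sumL-tab zero h f = refl
sumL-tab (suc n) h f = cong (f (h zero) +_) (sumL-tab n (λ i → h (suc i)) f)

sumL-allFin : ∀ n (f : Fin n → ℕ) → sumL (allFin n) f ≡ ΣF n f
sumL-allFin n f = sumL-tab n (λ i → i) f

sumL-swap : {A B : Set} (l : List A) (l' : List B) (f : A → B → ℕ) →
  sumL l (λ x → sumL l' (f x)) ≡ sumL l' (λ y → sumL l (λ x → f x y))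
sumL-swap [] l' f = sym (trans (sumL-const l' 0) (*-zeroʳ (length l')))
sumL-swap (x ∷ l) l' f = trans (cong (sumL l' (f x) +_) (sumL-swap l l' f)) (sym (sumL-+ l' (f x) _))

sumL-ΣF : {A : Set} (l : List A) (n : ℕ) (f : A → Fin n → ℕ) →
  sumL l (λ x → ΣF n (f x)) ≡ ΣF n (λ j → sumL l (λ x → f x j))
sumL-ΣF [] n f = sym (trans (ΣF-const n 0) (*-zeroʳ n))
sumL-ΣF (x ∷ l) n f = trans (cong (ΣF n (f x) +_) (sumL-ΣF l n f)) (sym (ΣF-+ n (f x) _))

Fun : ℕ → ℕ → Set
Fun N k = (Fin N → Fin k) → ℕ

-- F respects pointwise equality of assignments (function extensionality is not available).
Extensional : ∀ {N k} → Fun N k → Set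
Extensional {N} {k} F = ∀ (x y : Fin N → Fin k) → (∀ i → x i ≡ y i) → F x ≡ F y

upd : ∀ {N k} → (Fin N → Fin k) → Fin N → Fin k → Fin N → Fin k
upd x i a j = if eqᵇ j i then a else x j

sumOut : ∀ {N k} → Fin N → Fun N k → Fun N k
sumOut {N} {k} i F x = ΣF k (λ a → F (upd x i a))

Indep : ∀ {N k} → Fin N → Fun N k → Set
Indep i F = ∀ x a → F (upd x i a) ≡ F x

ΣX : ∀ N k → Fun N k → ℕ
ΣX N k F = sumL (allFuns N k) F

ΣX-suc : ∀ N k F → ΣX (suc N) k F ≡ ΣX N k (λ f → ΣF k (λ a → F (cons a f)))
ΣX-suc N k F = trans (sumL-concatMap _ (allFuns N k) F)
  (sumL-cong (allFuns N k) (λ f → trans (sumL-map (λ a → cons a f) (allFin k) F) (sumL-allFin k _)))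

ΣX-cong : ∀ N k {F G : Fun N k} → (∀ x → F x ≡ G x) → ΣX N k F ≡ ΣX N k G
ΣX-cong N k eq = sumL-cong (allFuns N k) eq

ΣX-mono : ∀ N k {F G : Fun N k} → (∀ x → F x ≤ G x) → ΣX N k F ≤ ΣX N k G
ΣX-mono N k le = sumL-mono (allFuns N k) le

ΣX-*ˡ : ∀ N k c (F : Fun N k) → c * ΣX N k F ≡ ΣX N k (λ x → c * F x)
ΣX-*ˡ N k c F = sumL-*ˡ (allFuns N k) c F

ΣX-const : ∀ N k c → ΣX N k (λ _ → c) ≡ k ^ N * c
ΣX-const zero k c = trans (+-identityʳ c) (sym (+-identityʳ c))
ΣX-const (suc N) k c = begin
    ΣX (suc N) k (λ _ → c)            ≡⟨ ΣX-suc N k _ ⟩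
    ΣX N k (λ f → ΣF k (λ a → c))     ≡⟨ ΣX-cong N k (λ f → ΣF-const k c) ⟩
    ΣX N k (λ f → k * c)              ≡⟨ ΣX-const N k (k * c) ⟩
    k ^ N * (k * c)                   ≡⟨ lem (k ^ N) k c ⟩
    k * k ^ N * c ∎
  where open ≡-Reasoning
        lem : ∀ a b c → a * (b * c) ≡ b * a * c
        lem = solve-∀

cons-ext : ∀ {N k} (a : Fin k) (f g : Fin N → Fin k) → (∀ i → f i ≡ g i) → ∀ i → cons a f i ≡ cons a g i
cons-ext a f g eq zero = refl
cons-ext a f g eq (suc i) = eq i

upd-cons-zero : ∀ {N k} (b a : Fin k) (f : Fin N → Fin k) → ∀ i → upd (cons b f) zero a i ≡ cons a f i
upd-cons-zero b a f zero = refl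
upd-cons-zero b a f (suc i) = refl

upd-cons-suc : ∀ {N k} (b a : Fin k) (f : Fin N → Fin k) j → ∀ i → upd (cons b f) (suc j) a i ≡ cons b (upd f j a) i
upd-cons-suc b a f j zero = refl
upd-cons-suc b a f j (suc i) = refl

cons-eta : ∀ {N k} (x : Fin (suc N) → Fin k) → ∀ i → x i ≡ cons (x zero) (λ j → x (suc j)) i
cons-eta x zero = refl
cons-eta x (suc i) = refl

ΣX-sumOut : ∀ N k (i : Fin N) (F : Fun N k) → Extensional F → ΣX N k (sumOut i F) ≡ k * ΣX N k F
ΣX-sumOut (suc N) k zero F ext = begin
    ΣX (suc N) k (sumOut zero F) ≡⟨ ΣX-suc N k _ ⟩
    ΣX N k (λ f → ΣF k (λ b → sumOut zero F (cons b f)))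
      ≡⟨ ΣX-cong N k (λ f → ΣF-cong k (λ b → ΣF-cong k (λ a → ext _ _ (upd-cons-zero b a f)))) ⟩
    ΣX N k (λ f → ΣF k (λ b → ΣF k (λ a → F (cons a f))))
      ≡⟨ ΣX-cong N k (λ f → ΣF-const k _) ⟩
    ΣX N k (λ f → k * ΣF k (λ a → F (cons a f)))
      ≡⟨ sym (ΣX-*ˡ N k k _) ⟩
    k * ΣX N k (λ f → ΣF k (λ a → F (cons a f)))
      ≡⟨ cong (k *_) (sym (ΣX-suc N k F)) ⟩
    k * ΣX (suc N) k F ∎
  where open ≡-Reasoning
ΣX-sumOut (suc N) k (suc j) F ext = begin
    ΣX (suc N) k (sumOut (suc j) F) ≡⟨ ΣX-suc N k _ ⟩
    ΣX N k (λ f → ΣF k (λ b → sumOut (suc j) F (cons b f)))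
      ≡⟨ ΣX-cong N k (λ f → ΣF-cong k (λ b → ΣF-cong k (λ a → ext _ _ (upd-cons-suc b a f j)))) ⟩
    ΣX N k (λ f → ΣF k (λ b → sumOut j (λ g → F (cons b g)) f))
      ≡⟨ sumL-ΣF (allFuns N k) k _ ⟩
    ΣF k (λ b → ΣX N k (sumOut j (λ g → F (cons b g))))
      ≡⟨ ΣF-cong k (λ b → ΣX-sumOut N k j _ (λ x y eq → ext _ _ (cons-ext b x y eq))) ⟩
    ΣF k (λ b → k * ΣX N k (λ g → F (cons b g)))
      ≡⟨ sym (ΣF-*ˡ k k _) ⟩
    k * ΣF k (λ b → ΣX N k (λ g → F (cons b g)))
      ≡⟨ cong (k *_) (sym (sumL-ΣF (allFuns N k) k _)) ⟩
    k * ΣX N k (λ f → ΣF k (λ b → F (cons b f)))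
      ≡⟨ cong (k *_) (sym (ΣX-suc N k F)) ⟩
    k * ΣX (suc N) k F ∎
  where open ≡-Reasoning

ΣF-*ʳ : ∀ n (f : Fin n → ℕ) c → ΣF n (λ i → f i * c) ≡ ΣF n f * c
ΣF-*ʳ n f c = trans (ΣF-cong n (λ i → *-comm (f i) c)) (trans (sym (ΣF-*ˡ n c f)) (*-comm c _))

prodSum : ∀ N k (g : Fin N → Fin k → ℕ) → ΣX N k (λ x → ΠF N (λ u → g u (x u))) ≡ ΠF N (λ u → ΣF k (g u))
prodSum zero k g = refl
prodSum (suc N) k g = begin
    ΣX (suc N) k (λ x → ΠF (suc N) (λ u → g u (x u))) ≡⟨ ΣX-suc N k _ ⟩
    ΣX N k (λ f → ΣF k (λ a → g zero a * ΠF N (λ u → g (suc u) (f u))))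
      ≡⟨ ΣX-cong N k (λ f → ΣF-*ʳ k (g zero) _) ⟩
    ΣX N k (λ f → ΣF k (g zero) * ΠF N (λ u → g (suc u) (f u)))
      ≡⟨ sym (ΣX-*ˡ N k (ΣF k (g zero)) (λ f → ΠF N (λ u → g (suc u) (f u)))) ⟩
    ΣF k (g zero) * ΣX N k (λ f → ΠF N (λ u → g (suc u) (f u)))
      ≡⟨ cong (ΣF k (g zero) *_) (prodSum N k (λ u → g (suc u))) ⟩
    ΠF (suc N) (λ u → ΣF k (g u)) ∎
  where open ≡-Reasoning

indep⇒constant : ∀ N k (F : Fun N k) → Extensional F → (∀ j → Indep j F) → ∀ x y → F x ≡ F y
indep⇒constant zero k F ext ind x y = ext x y (λ ())
indep⇒constant (suc N) k F ext indp x y = begin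
    F x ≡⟨ ext _ _ (cons-eta x) ⟩
    F (cons (x zero) x') ≡⟨ sym (step (x zero) x' (y zero)) ⟩
    F (cons (y zero) x') ≡⟨ indep⇒constant N k F' ext' indp' x' y' ⟩
    F (cons (y zero) y') ≡⟨ sym (ext _ _ (cons-eta y)) ⟩
    F y ∎
  where
  open ≡-Reasoning
  x' : Fin N → Fin k
  x' = λ j → x (suc j)
  y' : Fin N → Fin k
  y' = λ j → y (suc j)
  step : ∀ b f a → F (cons a f) ≡ F (cons b f)
  step b f a = trans (sym (ext _ _ (upd-cons-zero b a f))) (indp zero (cons b f) a)
  F' : Fun N k
  F' = λ f → F (cons (y zero) f)
  ext' : Extensional F'
  ext' f g eq = ext _ _ (cons-ext (y zero) f g eq)
  indp' : ∀ j → Indep j F'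
  indp' j f a = trans (sym (ext _ _ (upd-cons-suc (y zero) a f j))) (indp (suc j) (cons (y zero) f) a)

sumOut-cong : ∀ {N k} (i : Fin N) {F G : Fun N k} → (∀ x → F x ≡ G x) → ∀ x → sumOut i F x ≡ sumOut i G x
sumOut-cong {k = k} i eq x = ΣF-cong k (λ a → eq _)

upd-ext : ∀ {N k} (x y : Fin N → Fin k) i a → (∀ j → x j ≡ y j) → ∀ j → upd x i a j ≡ upd y i a j
upd-ext x y i a eq j with eqᵇ j i
... | true = refl
... | false = eq j

sumOut-ext : ∀ {N k} (i : Fin N) (F : Fun N k) → Extensional F → Extensional (sumOut i F)
sumOut-ext {k = k} i F ext x y eq = ΣF-cong k (λ a → ext _ _ (upd-ext x y i a eq))

upd-upd-same : ∀ {N k} (x : Fin N → Fin k) i a b → ∀ j → upd (upd x i a) i b j ≡ upd x i b j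
upd-upd-same x i a b j with eqᵇ j i
... | true = refl
... | false = refl

sumOut-kills : ∀ {N k} (i : Fin N) (F : Fun N k) → Extensional F → Indep i (sumOut i F)
sumOut-kills {k = k} i F ext x a = ΣF-cong k (λ b → ext _ _ (upd-upd-same x i a b))

upd-upd-comm : ∀ {N k} (x : Fin N → Fin k) i j a b → eqᵇ j i ≡ false →
  ∀ m → upd (upd x j a) i b m ≡ upd (upd x i b) j a m
upd-upd-comm x i j a b ne m with eqᵇ m i in e1 | eqᵇ m j in e2
... | true | true = ⊥-elim (false≢true (trans (sym ne) (subst (λ z → eqᵇ z i ≡ true) (eqᵇ-sound m j e2) e1)))
  where false≢true : false ≡ true → ⊥
        false≢true ()
... | true | false = refl
... | false | true = refl
... | false | false = refl

sumOut-indep : ∀ {N k} (i j : Fin N) (F : Fun N k) → Extensional F → Indep j F → Indep j (sumOut i F)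
sumOut-indep {k = k} i j F ext indj x a with eqᵇ j i in e
... | true rewrite eqᵇ-sound j i e = sumOut-kills i F ext x a
... | false = ΣF-cong k (λ b → trans (ext _ _ (upd-upd-comm x i j a b e)) (indj (upd x i b) a))

sumOutAll : ∀ {N k} → List (Fin N) → (Fin N → Bool) → Fun N k → Fun N k
sumOutAll [] m F x = F x
sumOutAll (j ∷ l) m F x = if m j then sumOut j (sumOutAll l m F) x else sumOutAll l m F x

sumOutAll-ext : ∀ {N k} l m (F : Fun N k) → Extensional F → Extensional (sumOutAll l m F)
sumOutAll-ext [] m F ext = ext
sumOutAll-ext (j ∷ l) m F ext x y eq with m j
... | true = sumOut-ext j _ (sumOutAll-ext l m F ext) x y eq
... | false = sumOutAll-ext l m F ext x y eq

sumOutAll-indep : ∀ {N k} l m (F : Fun N k) j → Extensional F → Indep j F → Indep j (sumOutAll l m F)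
sumOutAll-indep [] m F j ext ij = ij
sumOutAll-indep (i ∷ l) m F j ext ij x a with m i
... | true = sumOut-indep i j _ (sumOutAll-ext l m F ext) (sumOutAll-indep l m F j ext ij) x a
... | false = sumOutAll-indep l m F j ext ij x a

sumOutAll-kills : ∀ {N k} l m (F : Fun N k) j → Extensional F → j LM.∈ l → m j ≡ true → Indep j (sumOutAll l m F)
sumOutAll-kills (i ∷ l) m F j ext (here refl) mj x a rewrite mj = sumOut-kills j _ (sumOutAll-ext l m F ext) x a
sumOutAll-kills (i ∷ l) m F j ext (there jl) mj x a with m i
... | true = sumOut-indep i j _ (sumOutAll-ext l m F ext) (sumOutAll-kills l m F j ext jl mj) x a
... | false = sumOutAll-kills l m F j ext jl mj x a

ΣX-sumOutAll : ∀ {N k} l m (F : Fun N k) → Extensional F → ΣX N k (sumOutAll l m F) ≡ k ^ sumL l (λ j → ind (m j)) * ΣX N k F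
ΣX-sumOutAll {N} {k} [] m F ext = sym (+-identityʳ _)
ΣX-sumOutAll {N} {k} (j ∷ l) m F ext with m j
... | true = trans (ΣX-sumOut N k j _ (sumOutAll-ext l m F ext))
             (trans (cong (k *_) (ΣX-sumOutAll l m F ext)) (sym (*-assoc k _ _)))
... | false = ΣX-sumOutAll l m F ext

sumOutIter : ∀ {N k} → ℕ → Fin N → Fun N k → Fun N k
sumOutIter zero v F x = F x
sumOutIter (suc c) v F x = sumOut v (sumOutIter c v F) x

sumOutAll-single : ∀ {N k} l m (v : Fin N) (F : Fun N k) → (∀ j → m j ≡ true → j ≡ v) →
  ∀ x → sumOutAll l m F x ≡ sumOutIter (sumL l (λ j → ind (m j))) v F x
sumOutAll-single [] m v F h x = refl
sumOutAll-single (j ∷ l) m v F h x with m j in e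
... | true rewrite h j e = sumOut-cong v (sumOutAll-single l m v F h) x
... | false = sumOutAll-single l m v F h x

two-mul≤sq+sq-shift : ∀ P d → 2 * P * (P + d) ≤ P * P + (P + d) * (P + d)
two-mul≤sq+sq-shift P d = subst (2 * P * (P + d) ≤_) (lem P d) (m≤m+n (2 * P * (P + d)) (d * d))
  where lem : ∀ P d → 2 * P * (P + d) + d * d ≡ P * P + (P + d) * (P + d)
        lem = solve-∀

two-mul≤sq+sq : ∀ P Q → 2 * P * Q ≤ P * P + Q * Q
two-mul≤sq+sq P Q with ≤-total P Q
... | inj₁ le with m≤n⇒∃[o]m+o≡n le
...   | d , refl = two-mul≤sq+sq-shift P d
two-mul≤sq+sq P Q | inj₂ le with m≤n⇒∃[o]m+o≡n le
...   | d , refl = subst₂ _≤_ (lem1 Q d) (+-comm (Q * Q) _) (two-mul≤sq+sq-shift Q d)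
  where lem1 : ∀ Q d → 2 * Q * (Q + d) ≡ 2 * (Q + d) * Q
        lem1 = solve-∀

bernoulli : ∀ P Q j → suc j * P ^ j * Q ≤ Q ^ suc j + j * P ^ suc j
bernoulli P Q zero = ≤-reflexive (lem Q)
  where lem : ∀ Q → (1 + 0) * 1 * Q ≡ Q * 1 + 0 * (P * 1)
        lem = solve-∀
bernoulli P Q (suc j) = +-cancelʳ-≤ (j * (P * A) * Q) _ _ chain
  where
  A : ℕ
  A = P ^ j
  B : ℕ
  B = Q ^ j
  ih : suc j * A * Q ≤ Q * B + j * (P * A)
  ih = bernoulli P Q j
  ihQ : suc j * A * (Q * Q) ≤ Q * (Q * B) + j * (P * A) * Q
  ihQ = subst₂ _≤_ (l1 (suc j) A Q) (l2 Q B j P A) (*-monoˡ-≤ Q ih)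
    where l1 : ∀ a b c → a * b * c * c ≡ a * b * (c * c)
          l1 = solve-∀
          l2 : ∀ Q B j P A → (Q * B + j * (P * A)) * Q ≡ Q * (Q * B) + j * (P * A) * Q
          l2 = solve-∀
  sq2 : suc j * A * (2 * P * Q) ≤ suc j * A * (P * P + Q * Q)
  sq2 = *-monoʳ-≤ (suc j * A) (two-mul≤sq+sq P Q)
  chain : suc (suc j) * (P * A) * Q + j * (P * A) * Q ≤ Q * (Q * B) + suc j * (P * (P * A)) + j * (P * A) * Q
  chain = begin
    suc (suc j) * (P * A) * Q + j * (P * A) * Q ≡⟨ e1 j P A Q ⟩
    suc j * A * (2 * P * Q) ≤⟨ sq2 ⟩
    suc j * A * (P * P + Q * Q) ≡⟨ e2 j A P Q ⟩
    suc j * A * (Q * Q) + suc j * (P * (P * A)) ≤⟨ +-monoˡ-≤ _ ihQ ⟩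
    Q * (Q * B) + j * (P * A) * Q + suc j * (P * (P * A)) ≡⟨ e3 (Q * (Q * B)) (j * (P * A) * Q) _ ⟩
    Q * (Q * B) + suc j * (P * (P * A)) + j * (P * A) * Q ∎
    where
    open ≤-Reasoning
    e1 : ∀ j P A Q → suc (suc j) * (P * A) * Q + j * (P * A) * Q ≡ suc j * A * (2 * P * Q)
    e1 = solve-∀
    e2 : ∀ j A P Q → suc j * A * (P * P + Q * Q) ≡ suc j * A * (Q * Q) + suc j * (P * (P * A))
    e2 = solve-∀
    e3 : ∀ a b c → a + b + c ≡ a + c + b
    e3 = solve-∀

-- Two-variable weighted AM–GM: (m+1)^(m+1) z S^m ≤ m^m (S+z)^(m+1);
-- it is Bernoulli's inequality applied to P = (m+1)S, Q = m(S+z).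
amgm-step : ∀ m S z → suc m ^ suc m * z * S ^ m ≤ m ^ m * (S + z) ^ suc m
amgm-step zero S z = subst₂ _≤_ (l1 z) (l2 S z) (m≤n+m z S)
  where l1 : ∀ z → z ≡ (1 * 1) * z * 1
        l1 = solve-∀
        l2 : ∀ S z → S + z ≡ 1 * ((S + z) * 1)
        l2 = solve-∀
amgm-step m@(suc m') S z = *-cancelˡ-≤ m step3
  where
  a : ℕ
  a = m ^ m
  b : ℕ
  b = (S + z) ^ m
  c : ℕ
  c = suc m ^ m
  e : ℕ
  e = S ^ m
  T : suc m * (suc m * S) ^ m * (m * (S + z)) ≤ (m * (S + z)) ^ suc m + m * (suc m * S) ^ suc m
  T = bernoulli (suc m * S) (m * (S + z)) m
  pP : (suc m * S) ^ m ≡ c * e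
  pP = ^-distrib-* (suc m) S m
  pQ : (m * (S + z)) ^ m ≡ a * b
  pQ = ^-distrib-* m (S + z) m
  T' : suc m * (c * e) * (m * (S + z)) ≤ m * (S + z) * (a * b) + m * (suc m * S * (c * e))
  T' = subst₂ _≤_ (cong (λ t → suc m * t * (m * (S + z))) pP)
                 (cong₂ (λ u v → m * (S + z) * u + m * (suc m * S * v)) pQ pP) T
  step2 : m * suc m * c * e * S + m * suc m * c * e * z ≤ m * suc m * c * e * S + m * (S + z) * a * b
  step2 = subst₂ _≤_ (l1 m c e S z) (l2 m c e S z a b) T'
    where l1 : ∀ m c e S z → suc m * (c * e) * (m * (S + z)) ≡ m * suc m * c * e * S + m * suc m * c * e * z
          l1 = solve-∀
          l2 : ∀ m c e S z a b → m * (S + z) * (a * b) + m * (suc m * S * (c * e)) ≡ m * suc m * c * e * S + m * (S + z) * a * b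
          l2 = solve-∀
  step3 : m * (suc m ^ suc m * z * S ^ m) ≤ m * (m ^ m * (S + z) ^ suc m)
  step3 = subst₂ _≤_ (l3 m c e z) (l4 m S z a b) (+-cancelˡ-≤ _ _ _ step2)
    where l3 : ∀ m c e z → m * suc m * c * e * z ≡ m * (suc m * c * z * e)
          l3 = solve-∀
          l4 : ∀ m S z a b → m * (S + z) * a * b ≡ m * (a * ((S + z) * b))
          l4 = solve-∀

pow-self-pos : ∀ m → 0 < m ^ m
pow-self-pos zero = s≤s z≤n
pow-self-pos m@(suc _) = m^n>0 m m

amgm : ∀ N (d : Fin N → Bool) (z : Fin N → ℕ) →
  ΣF N (λ v → ind (d v)) ^ ΣF N (λ v → ind (d v)) * ΠF N (λ v → if d v then z v else 1)
    ≤ ΣF N (λ v → if d v then z v else 0) ^ ΣF N (λ v → ind (d v))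
amgm zero d z = ≤-refl
amgm (suc N) d z with d zero | amgm N (λ v → d (suc v)) (λ v → z (suc v))
... | false | ih = subst (λ t → ΣF N (λ v → ind (d (suc v))) ^ ΣF N (λ v → ind (d (suc v))) * t
                                ≤ ΣF N (λ v → if d (suc v) then z (suc v) else 0) ^ ΣF N (λ v → ind (d (suc v))))
                         (sym (*-identityˡ (ΠF N (λ v → if d (suc v) then z (suc v) else 1)))) ih
... | true | ih = *-cancelˡ-≤ (m ^ m) {{>-nonZero (pow-self-pos m)}} chain
  where
  m : ℕ
  m = ΣF N (λ v → ind (d (suc v)))
  Π' : ℕ
  Π' = ΠF N (λ v → if d (suc v) then z (suc v) else 1)
  S' : ℕ
  S' = ΣF N (λ v → if d (suc v) then z (suc v) else 0)
  chain : m ^ m * (suc m ^ suc m * (z zero * Π')) ≤ m ^ m * (z zero + S') ^ suc m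
  chain = begin
    m ^ m * (suc m ^ suc m * (z zero * Π')) ≡⟨ l1 (m ^ m) (suc m ^ suc m) (z zero) Π' ⟩
    suc m ^ suc m * z zero * (m ^ m * Π') ≤⟨ *-monoʳ-≤ (suc m ^ suc m * z zero) ih ⟩
    suc m ^ suc m * z zero * S' ^ m ≤⟨ amgm-step m S' (z zero) ⟩
    m ^ m * (S' + z zero) ^ suc m ≡⟨ cong (λ t → m ^ m * t ^ suc m) (+-comm S' (z zero)) ⟩
    m ^ m * (z zero + S') ^ suc m ∎
    where open ≤-Reasoning
          l1 : ∀ a b c d → a * (b * (c * d)) ≡ b * c * (a * d)
          l1 = solve-∀

ratio-sum₂-ordered : ∀ p → 1 ≤ p → ∀ K x1 x2 y1 y2 → x2 * y1 ≤ x1 * y2 →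
  x1 ^ p ≤ K * y1 ^ p → x2 ^ p ≤ K * y2 ^ p → (x1 + x2) ^ p ≤ K * (y1 + y2) ^ p
ratio-sum₂-ordered p@(suc _) _ K x1 x2 zero y2 r h1 h2 with m^n≡0⇒m≡0 x1 p (n≤0⇒n≡0 (subst (x1 ^ p ≤_) (*-zeroʳ K) h1))
... | refl = h2
ratio-sum₂-ordered p@(suc _) _ K x1 x2 y1@(suc _) y2 r h1 h2 = *-cancelʳ-≤ _ _ (y1 ^ p) {{m^n≢0 y1 p}} chain
  where
  base : (x1 + x2) * y1 ≤ x1 * (y1 + y2)
  base = subst₂ _≤_ (sym (*-distribʳ-+ y1 x1 x2)) (sym (*-distribˡ-+ x1 y1 y2)) (+-monoʳ-≤ (x1 * y1) r)
  chain : (x1 + x2) ^ p * y1 ^ p ≤ K * (y1 + y2) ^ p * y1 ^ p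
  chain = begin
    (x1 + x2) ^ p * y1 ^ p ≡⟨ sym (^-distrib-* (x1 + x2) y1 p) ⟩
    ((x1 + x2) * y1) ^ p ≤⟨ ^-monoˡ-≤ p base ⟩
    (x1 * (y1 + y2)) ^ p ≡⟨ ^-distrib-* x1 (y1 + y2) p ⟩
    x1 ^ p * (y1 + y2) ^ p ≤⟨ *-monoˡ-≤ ((y1 + y2) ^ p) h1 ⟩
    K * y1 ^ p * (y1 + y2) ^ p ≡⟨ l K (y1 ^ p) ((y1 + y2) ^ p) ⟩
    K * (y1 + y2) ^ p * y1 ^ p ∎
    where open ≤-Reasoning
          l : ∀ a b c → a * b * c ≡ a * c * b
          l = solve-∀

ratio-sum₂ : ∀ p → 1 ≤ p → ∀ K x1 x2 y1 y2 →
  x1 ^ p ≤ K * y1 ^ p → x2 ^ p ≤ K * y2 ^ p → (x1 + x2) ^ p ≤ K * (y1 + y2) ^ p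
ratio-sum₂ p p1 K x1 x2 y1 y2 h1 h2 with ≤-total (x2 * y1) (x1 * y2)
... | inj₁ r = ratio-sum₂-ordered p p1 K x1 x2 y1 y2 r h1 h2
... | inj₂ r = subst₂ (λ u v → u ^ p ≤ K * v ^ p) (+-comm x2 x1) (+-comm y2 y1)
                 (ratio-sum₂-ordered p p1 K x2 x1 y2 y1 r h2 h1)

ratio-sum : ∀ p → 1 ≤ p → ∀ K k (x y : Fin k → ℕ) → (∀ a → x a ^ p ≤ K * y a ^ p) →
  ΣF k x ^ p ≤ K * ΣF k y ^ p
ratio-sum (suc p) _ K zero x y h = z≤n
ratio-sum p p1 K (suc k) x y h = ratio-sum₂ p p1 K _ _ _ _ (h zero) (ratio-sum p p1 K k _ _ (λ a → h (suc a)))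

term≤ΣF : ∀ n (f : Fin n → ℕ) i → f i ≤ ΣF n f
term≤ΣF (suc n) f zero = m≤m+n _ _
term≤ΣF (suc n) f (suc i) = ≤-trans (term≤ΣF n (λ j → f (suc j)) i) (m≤n+m _ _)

ΠF-except : ∀ n → (Fin n → ℕ) → Fin n → ℕ
ΠF-except (suc n) g zero = ΠF n (λ i → g (suc i))
ΠF-except (suc n) g (suc v) = g zero * ΠF-except n (λ i → g (suc i)) v

ΠF-except-split : ∀ n (g : Fin n → ℕ) v → ΠF n g ≡ ΠF-except n g v * g v
ΠF-except-split (suc n) g zero = *-comm (g zero) _
ΠF-except-split (suc n) g (suc v) = trans (cong (g zero *_) (ΠF-except-split n (λ i → g (suc i)) v)) (sym (*-assoc (g zero) _ _))

ΣF-zero : ∀ n (f : Fin n → ℕ) → (∀ i → f i ≡ 0) → ΣF n f ≡ 0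
ΣF-zero n f h = trans (ΣF-cong n h) (trans (ΣF-const n 0) (*-zeroʳ n))

ΠF-if-split : ∀ n (d : Fin n → Bool) (X Y : Fin n → ℕ) →
  ΠF n (λ v → if d v then X v else Y v) ≡ ΠF n (λ v → if d v then X v else 1) * ΠF n (λ v → if d v then 1 else Y v)
ΠF-if-split n d X Y = trans (ΠF-cong n pw) (ΠF-* n _ _)
  where pw : ∀ v → (if d v then X v else Y v) ≡ (if d v then X v else 1) * (if d v then 1 else Y v)
        pw v with d v
        ... | true = sym (*-identityʳ _)
        ... | false = sym (+-identityʳ _)

ΣF-if0 : ∀ n (d : Fin n → Bool) c → ΣF n (λ v → if d v then c else 0) ≡ ΣF n (λ v → ind (d v)) * c
ΣF-if0 n d c = trans (ΣF-cong n pw) (ΣF-*ʳ n (λ v → ind (d v)) c)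
  where pw : ∀ v → (if d v then c else 0) ≡ ind (d v) * c
        pw v with d v
        ... | true = sym (+-identityʳ c)
        ... | false = refl

HolderHyp : ∀ p N (d : Fin N → Bool) k (f : Fin N → Fin k → ℕ) (c : Fin N → ℕ) (s : Fin k → ℕ) → Set
HolderHyp p N d k f c s = ∀ a → s a ^ p ≤ ΠF N (λ v → if d v then f v a else c v)

holder-degenerate : ∀ p → 1 ≤ p → ∀ N (d : Fin N → Bool) k f c (s : Fin k → ℕ) →
  HolderHyp p N d k f c s → ΠF N (λ v → if d v then ΣF k (f v) else 1) ≡ 0 → ΣF k s ≡ 0
holder-degenerate p@(suc _) _ N d k f c s hyp P≡0 = ΣF-zero k s (λ a → m^n≡0⇒m≡0 (s a) p (n≤0⇒n≡0 (bnd a)))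
  where
  C : ℕ
  C = ΠF N (λ v → if d v then 1 else c v)
  bnd : ∀ a → s a ^ p ≤ 0
  bnd a = begin
    s a ^ p ≤⟨ hyp a ⟩
    ΠF N (λ v → if d v then f v a else c v) ≤⟨ ΠF-mono N termwise ⟩
    ΠF N (λ v → if d v then ΣF k (f v) else c v) ≡⟨ ΠF-if-split N d _ c ⟩
    ΠF N (λ v → if d v then ΣF k (f v) else 1) * C ≡⟨ cong (_* C) P≡0 ⟩
    0 ∎
    where open ≤-Reasoning
          termwise : ∀ v → (if d v then f v a else c v) ≤ (if d v then ΣF k (f v) else c v)
          termwise v with d v
          ... | true = term≤ΣF k (f v) a
          ... | false = ≤-refl

holder-positive : ∀ p → 1 ≤ p → ∀ N (d : Fin N → Bool) → ΣF N (λ v → ind (d v)) ≡ p →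
  ∀ k f c (s : Fin k → ℕ) → HolderHyp p N d k f c s →
  ∀ P′ → ΠF N (λ v → if d v then ΣF k (f v) else 1) ≡ suc P′ →
  ΣF k s ^ p ≤ ΠF N (λ v → if d v then ΣF k (f v) else c v)
holder-positive p@(suc _) p1 N d cnt k f c s hyp P′ eqP = *-cancelʳ-≤ _ _ ((p * P) ^ p) {{m^n≢0 (p * P) p}} scaled
  where
  P : ℕ
  P = suc P′
  g : Fin N → ℕ
  g v = if d v then ΣF k (f v) else 1
  C : ℕ
  C = ΠF N (λ v → if d v then 1 else c v)
  -- the weight of v is P / g v, the product of the other g's
  w : Fin N → ℕ
  w v = ΠF-except N g v
  weq : ∀ v → P ≡ w v * g v
  weq v = trans (sym eqP) (ΠF-except-split N g v)
  Za : Fin k → ℕ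
  Za a = ΣF N (λ v → if d v then f v a * w v else 0)
  weighted : ∀ b fa wv G → P ≡ wv * (if b then G else 1) →
    (if b then fa * wv else 1) * (if b then G else 1) ≡ (if b then fa else 1) * (if b then P else 1)
  weighted true fa wv G eq rewrite eq = *-assoc fa wv G
  weighted false fa wv G eq = refl
  weightedSum : ∀ b (fs : Fin k → ℕ) wv → P ≡ wv * (if b then ΣF k fs else 1) →
    ΣF k (λ a → if b then fs a * wv else 0) ≡ (if b then P else 0)
  weightedSum true fs wv eq = trans (ΣF-*ʳ k fs wv) (trans (*-comm _ wv) (sym eq))
  weightedSum false fs wv eq = ΣF-zero k _ (λ _ → refl)
  -- multiplying the weighted product by P turns every weight back into P
  ident : ∀ a → ΠF N (λ v → if d v then f v a * w v else 1) * P ≡ ΠF N (λ v → if d v then f v a else 1) * P ^ p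
  ident a = begin
    ΠF N (λ v → if d v then f v a * w v else 1) * P ≡⟨ cong (ΠF N (λ v → if d v then f v a * w v else 1) *_) (sym eqP) ⟩
    ΠF N (λ v → if d v then f v a * w v else 1) * ΠF N g ≡⟨ sym (ΠF-* N _ g) ⟩
    ΠF N (λ v → (if d v then f v a * w v else 1) * g v) ≡⟨ ΠF-cong N (λ v → weighted (d v) (f v a) (w v) (ΣF k (f v)) (weq v)) ⟩
    ΠF N (λ v → (if d v then f v a else 1) * (if d v then P else 1)) ≡⟨ ΠF-* N _ _ ⟩
    ΠF N (λ v → if d v then f v a else 1) * ΠF N (λ v → if d v then P else 1) ≡⟨ cong (ΠF N (λ v → if d v then f v a else 1) *_) (trans (ΠF-if1 N d P) (cong (P ^_) cnt)) ⟩
    ΠF N (λ v → if d v then f v a else 1) * P ^ p ∎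
    where open ≡-Reasoning
  am : ∀ a → p ^ p * ΠF N (λ v → if d v then f v a * w v else 1) ≤ Za a ^ p
  am a = subst (λ t → t ^ t * ΠF N (λ v → if d v then f v a * w v else 1) ≤ Za a ^ t) cnt (amgm N d (λ v → f v a * w v))
  perA : ∀ a → (p * P * s a) ^ p ≤ (C * P) * Za a ^ p
  perA a = begin
    (p * P * s a) ^ p ≡⟨ trans (^-distrib-* (p * P) (s a) p) (cong (_* (s a ^ p)) (^-distrib-* p P p)) ⟩
    p ^ p * P ^ p * s a ^ p ≤⟨ *-monoʳ-≤ (p ^ p * P ^ p) (hyp a) ⟩
    p ^ p * P ^ p * ΠF N (λ v → if d v then f v a else c v) ≡⟨ cong (p ^ p * P ^ p *_) (ΠF-if-split N d _ c) ⟩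
    p ^ p * P ^ p * (ΠF N (λ v → if d v then f v a else 1) * C) ≡⟨ l1 (p ^ p) (P ^ p) (ΠF N (λ v → if d v then f v a else 1)) C ⟩
    C * p ^ p * (ΠF N (λ v → if d v then f v a else 1) * P ^ p) ≡⟨ cong (C * p ^ p *_) (sym (ident a)) ⟩
    C * p ^ p * (ΠF N (λ v → if d v then f v a * w v else 1) * P) ≡⟨ l2 C (p ^ p) (ΠF N (λ v → if d v then f v a * w v else 1)) P ⟩
    (C * P) * (p ^ p * ΠF N (λ v → if d v then f v a * w v else 1)) ≤⟨ *-monoʳ-≤ (C * P) (am a) ⟩
    (C * P) * Za a ^ p ∎
    where open ≤-Reasoning
          l1 : ∀ a b c d → a * b * (c * d) ≡ d * a * (c * b)
          l1 = solve-∀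
          l2 : ∀ a b c d → a * b * (c * d) ≡ (a * d) * (b * c)
          l2 = solve-∀
  sumZ : ΣF k Za ≡ p * P
  sumZ = begin
    ΣF k Za ≡⟨ ΣF-swap k N _ ⟩
    ΣF N (λ v → ΣF k (λ a → if d v then f v a * w v else 0)) ≡⟨ ΣF-cong N (λ v → weightedSum (d v) (f v) (w v) (weq v)) ⟩
    ΣF N (λ v → if d v then P else 0) ≡⟨ ΣF-if0 N d P ⟩
    ΣF N (λ v → ind (d v)) * P ≡⟨ cong (_* P) cnt ⟩
    p * P ∎
    where open ≡-Reasoning
  scaled : ΣF k s ^ p * (p * P) ^ p ≤ ΠF N (λ v → if d v then ΣF k (f v) else c v) * (p * P) ^ p
  scaled = begin
    ΣF k s ^ p * (p * P) ^ p ≡⟨ *-comm (ΣF k s ^ p) _ ⟩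
    (p * P) ^ p * ΣF k s ^ p ≡⟨ sym (^-distrib-* (p * P) (ΣF k s) p) ⟩
    (p * P * ΣF k s) ^ p ≡⟨ cong (_^ p) (ΣF-*ˡ k (p * P) s) ⟩
    ΣF k (λ a → p * P * s a) ^ p ≤⟨ ratio-sum p p1 (C * P) k _ _ perA ⟩
    (C * P) * ΣF k Za ^ p ≡⟨ cong (λ t → (C * P) * t ^ p) sumZ ⟩
    (C * P) * (p * P) ^ p ≡⟨ cong (_* (p * P) ^ p) (trans (*-comm C P) (sym (trans (ΠF-if-split N d _ c) (cong (_* C) eqP)))) ⟩
    ΠF N (λ v → if d v then ΣF k (f v) else c v) * (p * P) ^ p ∎
    where open ≤-Reasoning

-- Proof: with P = ∏_{d v} ∑_a f v a and weights w v = P / ∑_a f v a, AM–GM gives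
-- p^p ∏_{d v} f v a w v ≤ (Z a)^p with Z a = ∑_{d v} f v a w v, and ∑_a Z a = pP;
-- ratio-sum then sums the per-a bounds.  The case P = 0 forces all s_a = 0.
holder-step : ∀ p → 1 ≤ p → ∀ N (d : Fin N → Bool) → ΣF N (λ v → ind (d v)) ≡ p →
  ∀ k (f : Fin N → Fin k → ℕ) (c : Fin N → ℕ) (s : Fin k → ℕ) →
  HolderHyp p N d k f c s →
  ΣF k s ^ p ≤ ΠF N (λ v → if d v then ΣF k (f v) else c v)
holder-step p@(suc _) p1 N d cnt k f c s hyp with ΠF N (λ v → if d v then ΣF k (f v) else 1) in eqP
... | zero = subst (λ t → t ^ p ≤ _) (sym (holder-degenerate p p1 N d k f c s hyp eqP)) z≤n
... | suc P′ = holder-positive p p1 N d cnt k f c s hyp P′ eqP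

iterated-holder : ∀ {N k} p → 1 ≤ p → (act : Fin N → Bool) (dep : Fin N → Fin N → Bool) →
  (∀ i → act i ≡ true → ΣF N (λ v → ind (dep v i)) ≡ p) →
  (l : List (Fin N)) (S : Fun N k) (F : Fin N → Fun N k) → Extensional S → (∀ v → Extensional (F v)) →
  (∀ v j → dep v j ≡ false → Indep j (F v)) →
  (∀ x → S x ^ p ≤ ΠF N (λ v → F v x)) →
  ∀ x → sumOutAll l act S x ^ p ≤ ΠF N (λ v → sumOutAll l (λ j → act j ∧ dep v j) (F v) x)
iterated-holder p p1 act dep cnt [] S F extS extF indF hyp x = hyp x
iterated-holder {N} {k} p p1 act dep cnt (j ∷ l) S F extS extF indF hyp x with act j in e
... | false = iterated-holder p p1 act dep cnt l S F extS extF indF hyp x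
... | true = holder-step p p1 N (λ v → dep v j) (cnt j e) k
               (λ v a → sumOutAll l (λ i → act i ∧ dep v i) (F v) (upd x j a))
               (λ v → sumOutAll l (λ i → act i ∧ dep v i) (F v) x)
               (λ a → sumOutAll l act S (upd x j a)) hypA
  where
  hypA : ∀ a → sumOutAll l act S (upd x j a) ^ p ≤
    ΠF N (λ v → if dep v j then sumOutAll l (λ i → act i ∧ dep v i) (F v) (upd x j a) else sumOutAll l (λ i → act i ∧ dep v i) (F v) x)
  hypA a = ≤-trans (iterated-holder p p1 act dep cnt l S F extS extF indF hyp (upd x j a)) (≤-reflexive (ΠF-cong N pw))
    where
    pw : ∀ v → sumOutAll l (λ i → act i ∧ dep v i) (F v) (upd x j a) ≡
      (if dep v j then sumOutAll l (λ i → act i ∧ dep v i) (F v) (upd x j a) else sumOutAll l (λ i → act i ∧ dep v i) (F v) x)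
    pw v with dep v j in dv
    ... | true = refl
    ... | false = sumOutAll-indep l _ (F v) j (extF v) (indF v j dv) x a

false≢true : false ≡ true → ⊥
false≢true ()

allF : ∀ n → (Fin n → Bool) → Bool
allF zero q = true
allF (suc n) q = q zero ∧ allF n (λ i → q (suc i))

anyF : ∀ n → (Fin n → Bool) → Bool
anyF zero q = false
anyF (suc n) q = q zero ∨ anyF n (λ i → q (suc i))

ind-∧ : ∀ b c → ind (b ∧ c) ≡ ind b * ind c
ind-∧ true c = sym (+-identityʳ _)
ind-∧ false c = refl

ΠF-ind : ∀ n (q : Fin n → Bool) → ΠF n (λ i → ind (q i)) ≡ ind (allF n q)
ΠF-ind zero q = refl
ΠF-ind (suc n) q = trans (cong (ind (q zero) *_) (ΠF-ind n (λ i → q (suc i)))) (sym (ind-∧ (q zero) _))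

allF-elim : ∀ n (q : Fin n → Bool) → allF n q ≡ true → ∀ i → q i ≡ true
allF-elim (suc n) q h zero with q zero | h
... | true | _ = refl
allF-elim (suc n) q h (suc i) with q zero | h
... | true | h' = allF-elim n (λ j → q (suc j)) h' i

allF-intro : ∀ n (q : Fin n → Bool) → (∀ i → q i ≡ true) → allF n q ≡ true
allF-intro zero q h = refl
allF-intro (suc n) q h rewrite h zero = allF-intro n (λ i → q (suc i)) (λ i → h (suc i))

anyF-intro : ∀ n (q : Fin n → Bool) i → q i ≡ true → anyF n q ≡ true
anyF-intro (suc n) q zero h rewrite h = refl
anyF-intro (suc n) q (suc i) h with q zero
... | true = refl
... | false = anyF-intro n (λ j → q (suc j)) i h

anyF-elim : ∀ n (q : Fin n → Bool) → anyF n q ≡ true → Σ (Fin n) (λ i → q i ≡ true)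
anyF-elim (suc n) q h with q zero in e
... | true = zero , e
... | false with anyF-elim n (λ j → q (suc j)) h
...   | i , h' = suc i , h'

bool-ext : ∀ {b c : Bool} → (b ≡ true → c ≡ true) → (c ≡ true → b ≡ true) → b ≡ c
bool-ext {true} {true} f g = refl
bool-ext {true} {false} f g = sym (f refl)
bool-ext {false} {true} f g = g refl
bool-ext {false} {false} f g = refl

impl-intro : ∀ b c → (b ≡ true → c ≡ true) → not b ∨ c ≡ true
impl-intro true c h = h refl
impl-intro false c h = refl

impl-elim : ∀ b c → not b ∨ c ≡ true → b ≡ true → c ≡ true
impl-elim true c h refl = h

ind-allF-le1 : ∀ n q → ΠF n (λ i → ind (q i)) ≤ 1
ind-allF-le1 n q = subst (_≤ 1) (sym (ΠF-ind n q)) (ind≤1 _)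

ind-and : ∀ {A : Set} n (h : Fin n → A) (q : A → Bool) → ind (and (map q (Data.List.tabulate h))) ≡ ΠF n (λ i → ind (q (h i)))
ind-and zero h q = refl
ind-and (suc n) h q = trans (ind-∧ (q (h zero)) _) (cong (ind (q (h zero)) *_) (ind-and n (λ i → h (suc i)) q))

length-filter : ∀ {A : Set} (p : A → Bool) (l : List A) → length (filterᵇ p l) ≡ sumL l (λ x → ind (p x))
length-filter p [] = refl
length-filter p (x ∷ l) with p x
... | true = cong suc (length-filter p l)
... | false = length-filter p l

card : ∀ {n} (P : Subset n) → ∣ P ∣ ≡ ΣF n (λ i → ind (lookup P i))
card []ᵥ = refl
card (true ∷ᵥ P) = cong suc (card P)
card (false ∷ᵥ P) = card P

card-tab : ∀ n (f : Fin n → Bool) → ∣ vtab f ∣ ≡ ΣF n (λ i → ind (f i))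
card-tab n f = trans (card (vtab f)) (ΣF-cong n (λ i → cong ind (lookup∘tabulate f i)))

ifio : ∀ b → (if b then inside else outside) ≡ b
ifio true = refl
ifio false = refl

degree-eq : ∀ (G : Graph) v → degree G v ≡ ΣF (size G) (λ j → ind (adj G v j))
degree-eq G v = trans (card-tab (size G) _) (ΣF-cong (size G) (λ j → cong ind (ifio (adj G v j))))

module HomIndicator (G H : Graph) where
  N : ℕ
  N = size G
  k : ℕ
  k = size H

  edgeOk : (Fin N → Fin k) → Fin N → Fin N → Bool
  edgeOk x u v = not (adj G u v) ∨ adj H (x u) (x v)

  homℕ : Fun N k
  homℕ x = ΠF N (λ u → ΠF N (λ v → ind (edgeOk x u v)))

  homℕ-ext : Extensional homℕ
  homℕ-ext x y eq = ΠF-cong N (λ u → ΠF-cong N (λ v → cong₂ (λ a b → ind (not (adj G u v) ∨ adj H a b)) (eq u) (eq v)))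

  ind-isHomᵇ : ∀ x → ind (isHomᵇ G H x) ≡ homℕ x
  ind-isHomᵇ x = trans (ind-and N (λ i → i) _) (ΠF-cong N (λ u → ind-and N (λ i → i) _))

  homCount-eq : homCount G H ≡ ΣX N k homℕ
  homCount-eq = trans (length-filter _ (allFuns N k)) (sumL-cong (allFuns N k) ind-isHomᵇ)

  homℕ-bool : ∀ x → homℕ x ≡ ind (allF N (λ u → allF N (λ v → edgeOk x u v)))
  homℕ-bool x = trans (ΠF-cong N (λ u → ΠF-ind N (edgeOk x u))) (ΠF-ind N _)

module Lower (G H : Graph) (col : Fin (size G) → Bool)
             (bip : ∀ u v → adj G u v ≡ true → col u ≡ not (col v)) where
  open HomIndicator G H

  -- Maps sending white vertices into A and black vertices into B are homomorphisms,
  -- so their number |A|^#white |B|^#black is at most hom.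
  colourProduct≤hom : (A B : Subset k) → Complete H A B → ΠF N (λ u → if col u then ∣ A ∣ else ∣ B ∣) ≤ homCount G H
  colourProduct≤hom A B cAB = begin
      ΠF N (λ u → if col u then ∣ A ∣ else ∣ B ∣) ≡⟨ ΠF-cong N pwc ⟩
      ΠF N (λ u → ΣF k (λ a → ind (lookup (Col u) a))) ≡⟨ sym (prodSum N k (λ u a → ind (lookup (Col u) a))) ⟩
      ΣX N k Lx ≤⟨ ΣX-mono N k Lx≤ ⟩
      ΣX N k homℕ ≡⟨ sym homCount-eq ⟩
      homCount G H ∎
    where
    open ≤-Reasoning
    Col : Fin N → Subset k
    Col u = if col u then A else B
    Lx : Fun N k
    Lx x = ΠF N (λ u → ind (lookup (Col u) (x u)))
    pwc : ∀ u → (if col u then ∣ A ∣ else ∣ B ∣) ≡ ΣF k (λ a → ind (lookup (Col u) a))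
    pwc u with col u
    ... | true = card A
    ... | false = card B
    Lx≤ : ∀ x → Lx x ≤ homℕ x
    Lx≤ x with allF N (λ u → lookup (Col u) (x u)) in eL
    ... | false = subst (_≤ homℕ x) (sym (ΠF-ind N _)) (subst (λ t → ind t ≤ homℕ x) (sym eL) z≤n)
    ... | true = ≤-reflexive (trans (ΠF-ind N _) (trans (cong ind eL) (trans (cong ind (sym allT)) (sym (homℕ-bool x)))))
      where
      mem : ∀ u → lookup (Col u) (x u) ≡ true
      mem = allF-elim N _ eL
      edge : ∀ u v → adj G u v ≡ true → adj H (x u) (x v) ≡ true
      edge u v a with col u in cu | col v in cv | mem u | mem v | bip u v a
      ... | true | false | mu | mv | _ = cAB (x u) (x v) (lookup⇒[]= (x u) A mu) (lookup⇒[]= (x v) B mv)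
      ... | false | true | mu | mv | _ = trans (Graph.sym H (x u) (x v)) (cAB (x v) (x u) (lookup⇒[]= (x v) A mv) (lookup⇒[]= (x u) B mu))
      ... | true | true | _ | _ | ()
      ... | false | false | _ | _ | ()
      allT : allF N (λ u → allF N (λ v → edgeOk x u v)) ≡ true
      allT = allF-intro N _ (λ u → allF-intro N _ (λ v → impl-intro (adj G u v) _ (edge u v)))

  -- (|A||B|)^N = (|A|^#white |B|^#black)(|B|^#white |A|^#black) ≤ hom².
  lower : (e : ℕ) → IsEta H e → e ^ N ≤ homCount G H ^ 2
  lower e ((A , B , cAB , eq) , _) = begin
      e ^ N ≡⟨ cong (_^ N) (sym eq) ⟩
      (∣ A ∣ * ∣ B ∣) ^ N ≡⟨ sym (ΠF-const N _) ⟩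
      ΠF N (λ _ → ∣ A ∣ * ∣ B ∣) ≡⟨ ΠF-cong N pw ⟩
      ΠF N (λ u → (if col u then ∣ A ∣ else ∣ B ∣) * (if col u then ∣ B ∣ else ∣ A ∣)) ≡⟨ ΠF-* N _ _ ⟩
      ΠF N (λ u → if col u then ∣ A ∣ else ∣ B ∣) * ΠF N (λ u → if col u then ∣ B ∣ else ∣ A ∣)
        ≤⟨ *-mono-≤ (colourProduct≤hom A B cAB) (colourProduct≤hom B A cBA) ⟩
      homCount G H * homCount G H ≡⟨ cong (homCount G H *_) (sym (*-identityʳ _)) ⟩
      homCount G H ^ 2 ∎
    where
    open ≤-Reasoning
    cBA : Complete H B A
    cBA i j hi hj = trans (Graph.sym H i j) (cAB j i hj hi)
    pw : ∀ u → ∣ A ∣ * ∣ B ∣ ≡ (if col u then ∣ A ∣ else ∣ B ∣) * (if col u then ∣ B ∣ else ∣ A ∣)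
    pw u with col u
    ... | true = refl
    ... | false = *-comm ∣ A ∣ ∣ B ∣

-- Subsets of V(H) are encoded as maps σ : Fin k → Fin 2 so that ΣX ranges over them.
isOne : Fin 2 → Bool
isOne zero = false
isOne (suc _) = true

beq : Bool → Bool → Bool
beq true true = true
beq false false = true
beq true false = false
beq false true = false

beq-true : ∀ p q → beq p q ≡ true → p ≡ q
beq-true true true _ = refl
beq-true false false _ = refl

-- Phase 1 sums out the
-- white coordinates, phase 2 the black ones; the result is a constant bounded vertexwise.
module Upper (G H : Graph) (col : Fin (size G) → Bool)
             (bip : ∀ u v → adj G u v ≡ true → col u ≡ not (col v))
             (simple : IsSimple G) (n : ℕ) (n1 : 1 ≤ n) (reg : IsRegular n G)
             (e : ℕ) (eta : IsEta H e) (k' : ℕ) (hk : size H ≡ suc k') where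
  open HomIndicator G H

  instance
    nzk : NonZero k
    nzk = ≢-nonZero (λ eq → 0≢1+n (trans (sym eq) hk))

  L : List (Fin N)
  L = allFin N

  noEdgeSameColour : ∀ u v → col u ≡ col v → adj G u v ≡ false
  noEdgeSameColour u v same with adj G u v in a
  ... | false = refl
  ... | true = ⊥-elim (not-¬ same (bip u v a))

  edgeTest : Fin N → Fun N k
  edgeTest v x = ΠF N (λ u → ind (not (adj G u v) ∨ adj H (x u) (x v)))

  edgeTest-ext : ∀ v → Extensional (edgeTest v)
  edgeTest-ext v x y eq = ΠF-cong N (λ u → cong₂ (λ a b → ind (not (adj G u v) ∨ adj H a b)) (eq u) (eq v))

  edgeTest≤1 : ∀ v x → edgeTest v x ≤ 1
  edgeTest≤1 v x = ind-allF-le1 N _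

  edgeTest-indep : ∀ v j → eqᵇ v j ≡ false → adj G j v ≡ false → Indep j (edgeTest v)
  edgeTest-indep v j fv aj x a = ΠF-cong N pw
    where
    pw : ∀ u → ind (not (adj G u v) ∨ adj H (upd x j a u) (upd x j a v)) ≡ ind (not (adj G u v) ∨ adj H (x u) (x v))
    pw u rewrite fv with eqᵇ u j in eu
    ... | false = refl
    ... | true with eqᵇ-sound u j eu
    ...   | refl rewrite aj = refl

  -- Initial factors: the edge tests at white vertices; black factors are dropped (≤ 1).
  F0 : Fin N → Fun N k
  F0 v x = if col v then edgeTest v x else 1

  F0-ext : ∀ v → Extensional (F0 v)
  F0-ext v x y eq with col v
  ... | true = edgeTest-ext v x y eq
  ... | false = refl

  dep : Fin N → Fin N → Bool
  dep v j = col v ∧ (eqᵇ v j ∨ adj G j v)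

  dep-false : ∀ v j → col v ≡ true → dep v j ≡ false → (eqᵇ v j ≡ false) × (adj G j v ≡ false)
  dep-false v j cv d = ∨-conicalˡ _ _ d′ , ∨-conicalʳ _ _ d′
    where d′ = subst (λ t → (t ∧ (eqᵇ v j ∨ adj G j v)) ≡ false) cv d

  F0-indep : ∀ v j → dep v j ≡ false → Indep j (F0 v)
  F0-indep v j d x a with col v in cv
  ... | false = refl
  ... | true = edgeTest-indep v j (∨-conicalˡ _ _ d) (∨-conicalʳ _ _ d) x a

  -- A white coordinate i is depended on only by its own factor; a black one by its n
  -- (white) neighbours.  These are the exponents of the two Hölder phases.
  dep-white : ∀ v i → col i ≡ true → dep v i ≡ eqᵇ v i
  dep-white v i ci with eqᵇ v i in e
  ... | true with eqᵇ-sound v i e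
  ...   | refl rewrite ci = refl
  dep-white v i ci | false with col v in cv
  ... | false = refl
  ... | true = noEdgeSameColour i v (trans ci (sym cv))

  dep-black : ∀ v i → col i ≡ false → dep v i ≡ adj G i v
  dep-black v i ci with eqᵇ v i in e
  ... | true with eqᵇ-sound v i e
  ...   | refl rewrite ci = sym (simple v)
  dep-black v i ci | false with col v in cv
  ... | false = sym (noEdgeSameColour i v (trans ci (sym cv)))
  ... | true = refl

  dependents-white : ∀ i → col i ≡ true → ΣF N (λ v → ind (dep v i)) ≡ 1
  dependents-white i ci = trans (ΣF-cong N (λ v → cong ind (dep-white v i ci))) (ΣF-eqᵇ N i)

  deg : ∀ v → ΣF N (λ u → ind (adj G v u)) ≡ n
  deg v = trans (sym (degree-eq G v)) (reg v)

  dependents-black : ∀ i → not (col i) ≡ true → ΣF N (λ v → ind (dep v i)) ≡ n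
  dependents-black i ci = trans (ΣF-cong N (λ v → cong ind (dep-black v i (not-injective ci)))) (deg i)

  S0≤ΠF0 : ∀ x → homℕ x ^ 1 ≤ ΠF N (λ v → F0 v x)
  S0≤ΠF0 x = begin
      homℕ x ^ 1 ≡⟨ *-identityʳ _ ⟩
      homℕ x ≡⟨ ΠF-swap N N _ ⟩
      ΠF N (λ v → edgeTest v x) ≤⟨ ΠF-mono N pw ⟩
      ΠF N (λ v → F0 v x) ∎
    where
    open ≤-Reasoning
    pw : ∀ v → edgeTest v x ≤ F0 v x
    pw v with col v
    ... | true = ≤-refl
    ... | false = edgeTest≤1 v x

  S1 : Fun N k
  S1 = sumOutAll L col homℕ

  F1 : Fin N → Fun N k
  F1 v = sumOutAll L (λ j → col j ∧ dep v j) (F0 v)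

  phase₁ : ∀ x → S1 x ^ 1 ≤ ΠF N (λ v → F1 v x)
  phase₁ = iterated-holder 1 ≤-refl col dep dependents-white L homℕ F0 homℕ-ext F0-ext F0-indep S0≤ΠF0

  -- The star sum at v: ∑_a ∏_{u ∼ v} [x u ∼ a], the number of ways to extend x to v.
  star : Fin N → Fun N k
  star v = sumOut v (edgeTest v)

  mask-white : ∀ v → col v ≡ true → ∀ j → (col j ∧ dep v j) ≡ eqᵇ j v
  mask-white v cv j rewrite cv with col j in cj
  ... | true = trans (trans (cong (eqᵇ v j ∨_) (noEdgeSameColour j v (trans cj (sym cv)))) (∨-identityʳ _)) (eqᵇ-sym v j)
  ... | false with eqᵇ j v in e
  ...   | false = refl
  ...   | true with eqᵇ-sound j v e
  ...     | refl with trans (sym cj) cv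
  ...       | ()

  sumL-L : ∀ (m : Fin N → Bool) → sumL L (λ j → ind (m j)) ≡ ΣF N (λ j → ind (m j))
  sumL-L m = sumL-allFin N _

  F1-white : ∀ v → col v ≡ true → ∀ x → F1 v x ≡ star v x
  F1-white v cv x = trans (sumOutAll-single L _ v (F0 v) (λ j h → eqᵇ-sound j v (trans (sym (mask-white v cv j)) h)) x)
                 (trans (cong (λ t → sumOutIter t v (F0 v) x) cnt) (sumOut-cong v (λ y → g0 y) x))
    where
    cnt : sumL L (λ j → ind (col j ∧ dep v j)) ≡ 1
    cnt = trans (sumL-L _) (trans (ΣF-cong N (λ j → cong ind (mask-white v cv j))) (ΣF-eqᵇ N v))
    g0 : ∀ y → F0 v y ≡ edgeTest v y
    g0 y = cong (λ t → if t then edgeTest v y else 1) cv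

  F1-black : ∀ v → col v ≡ false → ∀ x → F1 v x ≡ 1
  F1-black v cv x = trans (sumOutAll-single L _ v (F0 v) (λ j h → ⊥-elim (false≢true (trans (sym (mF j)) h))) x)
                 (trans (cong (λ t → sumOutIter t v (F0 v) x) cnt) g0)
    where
    mF : ∀ j → (col j ∧ dep v j) ≡ false
    mF j = trans (cong (λ t → col j ∧ (t ∧ (eqᵇ v j ∨ adj G j v))) cv) (∧-zeroʳ (col j))
    cnt : sumL L (λ j → ind (col j ∧ dep v j)) ≡ 0
    cnt = trans (sumL-L _) (ΣF-zero N _ (λ j → cong ind (mF j)))
    g0 : F0 v x ≡ 1
    g0 = cong (λ t → if t then edgeTest v x else 1) cv

  F1≡star : ∀ v x → F1 v x ≡ (if col v then star v x else 1)
  F1≡star v x = aux (col v) refl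
    where
    aux : ∀ b → col v ≡ b → F1 v x ≡ (if col v then star v x else 1)
    aux true cv = trans (F1-white v cv x) (cong (λ t → if t then star v x else 1) (sym cv))
    aux false cv = trans (F1-black v cv x) (cong (λ t → if t then star v x else 1) (sym cv))

  F1ⁿ : Fin N → Fun N k
  F1ⁿ v x = (if col v then star v x else 1) ^ n

  S1ⁿ≤ΠF1ⁿ : ∀ x → S1 x ^ n ≤ ΠF N (λ v → F1ⁿ v x)
  S1ⁿ≤ΠF1ⁿ x = begin
      S1 x ^ n ≤⟨ ^-monoˡ-≤ n s1le ⟩
      ΠF N (λ v → if col v then star v x else 1) ^ n ≡⟨ sym (ΠF-^ N _ n) ⟩
      ΠF N (λ v → F1ⁿ v x) ∎
    where
    open ≤-Reasoning
    s1le : S1 x ≤ ΠF N (λ v → if col v then star v x else 1)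
    s1le = ≤-trans (subst (_≤ ΠF N (λ v → F1 v x)) (*-identityʳ _) (phase₁ x)) (≤-reflexive (ΠF-cong N (λ v → F1≡star v x)))

  S1-ext : Extensional S1
  S1-ext = sumOutAll-ext L col homℕ homℕ-ext

  star-ext : ∀ v → Extensional (star v)
  star-ext v = sumOut-ext v (edgeTest v) (edgeTest-ext v)

  F1ⁿ-ext : ∀ v → Extensional (F1ⁿ v)
  F1ⁿ-ext v x y eq = cong (λ t → (if col v then t else 1) ^ n) (star-ext v x y eq)

  F1ⁿ-indep : ∀ v j → dep v j ≡ false → Indep j (F1ⁿ v)
  F1ⁿ-indep v j d x a = cong (_^ n) (aux (col v) refl)
    where
    aux : ∀ b → col v ≡ b → (if col v then star v (upd x j a) else 1) ≡ (if col v then star v x else 1)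
    aux false cv = trans (cong (λ t → if t then star v (upd x j a) else 1) cv) (cong (λ t → if t then star v x else 1) (sym cv))
    aux true cv = trans (cong (λ t → if t then star v (upd x j a) else 1) cv)
                    (trans (sumOut-indep v j (edgeTest v) (edgeTest-ext v) (edgeTest-indep v j (proj₁ (dep-false v j cv d)) (proj₂ (dep-false v j cv d))) x a)
                           (cong (λ t → if t then star v x else 1) (sym cv)))

  -- Phase 2 sums out every black coordinate (exponent n: each has n white neighbours).
  phase₂ : ∀ x → sumOutAll L (λ j → not (col j)) S1 x ^ n ≤ ΠF N (λ v → sumOutAll L (λ j → not (col j) ∧ dep v j) (F1ⁿ v) x)
  phase₂ = iterated-holder n n1 (λ j → not (col j)) dep dependents-black L S1 F1ⁿ S1-ext F1ⁿ-ext F1ⁿ-indep S1ⁿ≤ΠF1ⁿ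

  S2 : Fun N k
  S2 = sumOutAll L (λ j → not (col j)) S1

  F2 : Fin N → Fun N k
  F2 v = sumOutAll L (λ j → not (col j) ∧ dep v j) (F1ⁿ v)

  S2-ext : Extensional S2
  S2-ext = sumOutAll-ext L _ S1 S1-ext

  S2-indep : ∀ j → Indep j S2
  S2-indep j = aux (col j) refl
    where
    aux : ∀ b → col j ≡ b → Indep j S2
    aux true cj = sumOutAll-indep L _ S1 j S1-ext (sumOutAll-kills L col homℕ j homℕ-ext (∈-allFin j) cj)
    aux false cj = sumOutAll-kills L _ S1 j S1-ext (∈-allFin j) (cong not cj)

  F1ⁿ-kills : ∀ v → col v ≡ true → Indep v (F1ⁿ v)
  F1ⁿ-kills v cv x a = cong (_^ n)
    (trans (cong (λ t → if t then star v (upd x v a) else 1) cv)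
      (trans (sumOut-kills v (edgeTest v) (edgeTest-ext v) x a) (cong (λ t → if t then star v x else 1) (sym cv))))

  ∨-true-l : ∀ b c → b ∨ c ≡ true → c ≡ false → b ≡ true
  ∨-true-l true c _ _ = refl
  ∨-true-l false true _ ()

  F1ⁿ-indep′ : ∀ v j → (not (col j) ∧ dep v j) ≡ false → Indep j (F1ⁿ v)
  F1ⁿ-indep′ v j em = aux (dep v j) refl
    where
    aux : ∀ b → dep v j ≡ b → Indep j (F1ⁿ v)
    aux false dj = F1ⁿ-indep v j dj
    aux true dj = subst (λ t → Indep t (F1ⁿ v)) vj (F1ⁿ-kills v cv)
      where
      ncj : not (col j) ≡ false
      ncj = trans (sym (∧-identityʳ (not (col j)))) (trans (cong (not (col j) ∧_) (sym dj)) em)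
      cj : col j ≡ true
      cj with col j | ncj
      ... | true | _ = refl
      cv : col v ≡ true
      cv = ∧-conicalˡ _ _ dj
      vj : v ≡ j
      vj = eqᵇ-sound v j (∨-true-l _ _ (∧-conicalʳ _ _ dj) (noEdgeSameColour j v (trans cj (sym cv))))

  F2-ext : ∀ v → Extensional (F2 v)
  F2-ext v = sumOutAll-ext L _ (F1ⁿ v) (F1ⁿ-ext v)

  F2-indep : ∀ v j → Indep j (F2 v)
  F2-indep v j = aux (not (col j) ∧ dep v j) refl
    where
    aux : ∀ b → (not (col j) ∧ dep v j) ≡ b → Indep j (F2 v)
    aux true e = sumOutAll-kills L _ (F1ⁿ v) j (F1ⁿ-ext v) (∈-allFin j) e
    aux false e = sumOutAll-indep L _ (F1ⁿ v) j (F1ⁿ-ext v) (F1ⁿ-indep′ v j e)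

  -- Since everything is constant, evaluate at any fixed assignment x₀.
  a₀ : Fin k
  a₀ = subst Fin (sym hk) zero

  x₀ : Fin N → Fin k
  x₀ _ = a₀

  T : ℕ
  T = homCount G H

  ΣX-constantFun : ∀ (F : Fun N k) → Extensional F → (∀ j → Indep j F) → ΣX N k F ≡ k ^ N * F x₀
  ΣX-constantFun F ext ind = trans (ΣX-cong N k (λ x → indep⇒constant N k F ext ind x x₀)) (ΣX-const N k _)

  -- The total sum is preserved up to the factor k^N, so S2 is the homomorphism count.
  S2≡hom : S2 x₀ ≡ T
  S2≡hom = *-cancelˡ-≡ (S2 x₀) T (k ^ N) {{m^n≢0 k N}} (trans (sym (ΣX-constantFun S2 S2-ext S2-indep)) eqB)
    where
    c1 : ℕ
    c1 = sumL L (λ j → ind (col j))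
    c2 : ℕ
    c2 = sumL L (λ j → ind (not (col j)))
    c21 : c2 + c1 ≡ N
    c21 = trans (+-comm c2 c1) (trans (cong₂ _+_ (sumL-L col) (sumL-L (λ j → not (col j)))) (ΣF-split N col))
    eqB : ΣX N k S2 ≡ k ^ N * T
    eqB = begin
      ΣX N k S2 ≡⟨ ΣX-sumOutAll L _ S1 S1-ext ⟩
      k ^ c2 * ΣX N k S1 ≡⟨ cong (k ^ c2 *_) (ΣX-sumOutAll L col homℕ homℕ-ext) ⟩
      k ^ c2 * (k ^ c1 * ΣX N k homℕ) ≡⟨ sym (*-assoc (k ^ c2) _ _) ⟩
      k ^ c2 * k ^ c1 * ΣX N k homℕ ≡⟨ cong (_* ΣX N k homℕ) (sym (^-distribˡ-+-* k c2 c1)) ⟩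
      k ^ (c2 + c1) * ΣX N k homℕ ≡⟨ cong₂ (λ a b → k ^ a * b) c21 (sym homCount-eq) ⟩
      k ^ N * T ∎
      where open ≡-Reasoning

  Q : ℕ
  Q = 2 ^ k * e ^ n

  -- Group assignments by the image σ ⊆ V(H) of the
  -- neighbourhood of v: then star = |common neighbourhood of σ|, |σ| · that ≤ e, and
  -- the assignments with image σ are at most those mapping N(v) into σ.
  module StarBound (v : Fin N) where
    starCount : Fun N k
    starCount x = ΣF k (λ a → ΠF N (λ u → ind (not (adj G u v) ∨ adj H (x u) a)))

    star≡starCount : ∀ x → star v x ≡ starCount x
    star≡starCount x = ΣF-cong k (λ a → ΠF-cong N (λ u → pw a u))
      where
      pw : ∀ a u → ind (not (adj G u v) ∨ adj H (upd x v a u) (upd x v a v)) ≡ ind (not (adj G u v) ∨ adj H (x u) a)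
      pw a u rewrite eqᵇ-refl v with eqᵇ u v in eu
      ... | false = refl
      ... | true with eqᵇ-sound u v eu
      ...   | refl rewrite simple u = refl

    image : (Fin N → Fin k) → Fin k → Bool
    image x b = anyF N (λ u → adj G u v ∧ eqᵇ (x u) b)

    matches : (Fin k → Fin 2) → (Fin N → Fin k) → Bool
    matches σ x = allF k (λ b → beq (isOne (σ b)) (image x b))

    unique-match : ∀ x → ΣX k 2 (λ σ → ind (matches σ x)) ≡ 1
    unique-match x = begin
      ΣX k 2 (λ σ → ind (matches σ x)) ≡⟨ ΣX-cong k 2 (λ σ → sym (ΠF-ind k _)) ⟩
      ΣX k 2 (λ σ → ΠF k (λ b → ind (beq (isOne (σ b)) (image x b)))) ≡⟨ prodSum k 2 (λ b a → ind (beq (isOne a) (image x b))) ⟩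
      ΠF k (λ b → ΣF 2 (λ a → ind (beq (isOne a) (image x b)))) ≡⟨ ΠF-cong k pw ⟩
      ΠF k (λ _ → 1) ≡⟨ trans (ΠF-const k 1) (^-zeroˡ k) ⟩
      1 ∎
      where
      open ≡-Reasoning
      pw : ∀ b → ΣF 2 (λ a → ind (beq (isOne a) (image x b))) ≡ 1
      pw b with image x b
      ... | true = refl
      ... | false = refl

    commonNbrs : (Fin k → Fin 2) → ℕ
    commonNbrs σ = ΣF k (λ a → ΠF k (λ b → ind (not (isOne (σ b)) ∨ adj H b a)))

    size-σ : (Fin k → Fin 2) → ℕ
    size-σ σ = ΣF k (λ b → ind (isOne (σ b)))

    inside-σ : (Fin k → Fin 2) → Fun N k
    inside-σ σ x = ΠF N (λ u → ind (not (adj G u v) ∨ isOne (σ (x u))))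

    matched-bound : ∀ σ x → ind (matches σ x) * starCount x ^ n ≤ inside-σ σ x * commonNbrs σ ^ n
    matched-bound σ x with matches σ x in em
    ... | false = z≤n
    ... | true = ≤-reflexive (trans (*-identityˡ _) (trans (cong (_^ n) ccEq) (sym (trans (cong (_* commonNbrs σ ^ n) subOne) (*-identityˡ _)))))
      where
      mt : ∀ b → isOne (σ b) ≡ image x b
      mt b = beq-true _ _ (allF-elim k _ em b)
      witness : ∀ u → adj G u v ≡ true → image x (x u) ≡ true
      witness u auv = anyF-intro N _ u (subst (λ t → t ∧ eqᵇ (x u) (x u) ≡ true) (sym auv) (eqᵇ-refl (x u)))
      subOne : inside-σ σ x ≡ 1
      subOne = trans (ΠF-ind N _) (cong ind (allF-intro N _ (λ u → impl-intro (adj G u v) _ (λ auv → trans (mt (x u)) (witness u auv)))))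
      ccEq : starCount x ≡ commonNbrs σ
      ccEq = ΣF-cong k (λ a → trans (ΠF-ind N _) (trans (cong ind (bool-ext (f a) (g a))) (sym (ΠF-ind k _))))
        where
        f : ∀ a → allF N (λ u → not (adj G u v) ∨ adj H (x u) a) ≡ true → allF k (λ b → not (isOne (σ b)) ∨ adj H b a) ≡ true
        f a h = allF-intro k _ (λ b → impl-intro (isOne (σ b)) _ (λ ob → step b (anyF-elim N _ (trans (sym (mt b)) ob))))
          where
          step : ∀ b → Σ (Fin N) (λ u → (adj G u v ∧ eqᵇ (x u) b) ≡ true) → adj H b a ≡ true
          step b (u , pu) = subst (λ t → adj H t a ≡ true) (eqᵇ-sound (x u) b (∧-conicalʳ _ _ pu))
                              (impl-elim _ _ (allF-elim N _ h u) (∧-conicalˡ _ _ pu))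
        g : ∀ a → allF k (λ b → not (isOne (σ b)) ∨ adj H b a) ≡ true → allF N (λ u → not (adj G u v) ∨ adj H (x u) a) ≡ true
        g a h = allF-intro N _ (λ u → impl-intro (adj G u v) _ (λ auv → impl-elim _ _ (allF-elim k _ h (x u)) (trans (mt (x u)) (witness u auv))))

    ΣF-inside-σ : ∀ σ u → ΣF k (λ a → ind (not (adj G u v) ∨ isOne (σ a))) ≡ (if adj G u v then size-σ σ else k)
    ΣF-inside-σ σ u with adj G u v
    ... | true = refl
    ... | false = trans (ΣF-const k 1) (*-identityʳ k)

    -- σ and its common neighbourhood are completely joined, so η bounds the product.
    size-σ*commonNbrs≤e : ∀ σ → size-σ σ * commonNbrs σ ≤ e
    size-σ*commonNbrs≤e σ = subst₂ (λ a b → a * b ≤ e) cA cB (proj₂ eta A B comp)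
      where
      A : Subset k
      A = vtab (λ b → isOne (σ b))
      B : Subset k
      B = vtab (λ a → allF k (λ b → not (isOne (σ b)) ∨ adj H b a))
      cA : ∣ A ∣ ≡ size-σ σ
      cA = card-tab k _
      cB : ∣ B ∣ ≡ commonNbrs σ
      cB = trans (card-tab k _) (ΣF-cong k (λ a → sym (ΠF-ind k _)))
      comp : Complete H A B
      comp i j hi hj = impl-elim _ _ (allF-elim k _ hB i) hA
        where
        hA : isOne (σ i) ≡ true
        hA = trans (sym (lookup∘tabulate _ i)) ([]=⇒lookup hi)
        hB : allF k (λ b → not (isOne (σ b)) ∨ adj H b j) ≡ true
        hB = trans (sym (lookup∘tabulate _ j)) ([]=⇒lookup hj)

    deg′ : ΣF N (λ u → ind (adj G u v)) ≡ n
    deg′ = trans (ΣF-cong N (λ u → cong ind (Graph.sym G u v))) (deg v)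

    bound-per-σ : ∀ σ → k ^ n * (ΠF N (λ u → if adj G u v then size-σ σ else k) * commonNbrs σ ^ n) ≤ k ^ N * e ^ n
    bound-per-σ σ = begin
      k ^ n * (ΠF N (λ u → if adj G u v then size-σ σ else k) * commonNbrs σ ^ n)
        ≡⟨ cong₂ (λ a b → a * (ΠF N (λ u → if adj G u v then size-σ σ else k) * b)) (sym (pif k)) (sym (pif (commonNbrs σ))) ⟩
      ΠF N (λ u → if adj G u v then k else 1) * (ΠF N (λ u → if adj G u v then size-σ σ else k) * ΠF N (λ u → if adj G u v then commonNbrs σ else 1))
        ≡⟨ cong (ΠF N (λ u → if adj G u v then k else 1) *_) (sym (ΠF-* N _ _)) ⟩
      ΠF N (λ u → if adj G u v then k else 1) * ΠF N (λ u → (if adj G u v then size-σ σ else k) * (if adj G u v then commonNbrs σ else 1))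
        ≡⟨ sym (ΠF-* N _ _) ⟩
      ΠF N (λ u → (if adj G u v then k else 1) * ((if adj G u v then size-σ σ else k) * (if adj G u v then commonNbrs σ else 1)))
        ≤⟨ ΠF-mono N pw ⟩
      ΠF N (λ u → k * (if adj G u v then e else 1)) ≡⟨ ΠF-* N _ _ ⟩
      ΠF N (λ u → k) * ΠF N (λ u → if adj G u v then e else 1) ≡⟨ cong₂ _*_ (ΠF-const N k) (pif e) ⟩
      k ^ N * e ^ n ∎
      where
      open ≤-Reasoning
      pif : ∀ c → ΠF N (λ u → if adj G u v then c else 1) ≡ c ^ n
      pif c = trans (ΠF-if1 N (λ u → adj G u v) c) (cong (c ^_) deg′)
      pw : ∀ u → (if adj G u v then k else 1) * ((if adj G u v then size-σ σ else k) * (if adj G u v then commonNbrs σ else 1)) ≤ k * (if adj G u v then e else 1)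
      pw u with adj G u v
      ... | true = *-monoʳ-≤ k (size-σ*commonNbrs≤e σ)
      ... | false = ≤-reflexive (trans (*-identityˡ _) refl)

    -- The summed star bound; k^n accounts for the n summed-out black neighbours.
    starBound : k ^ n * ΣX N k (λ x → star v x ^ n) ≤ k ^ N * Q
    starBound = begin
      k ^ n * ΣX N k (λ x → star v x ^ n) ≡⟨ cong (k ^ n *_) step1 ⟩
      k ^ n * ΣX k 2 (λ σ → ΣX N k (λ x → ind (matches σ x) * starCount x ^ n)) ≤⟨ *-monoʳ-≤ (k ^ n) (ΣX-mono k 2 (λ σ → ΣX-mono N k (matched-bound σ))) ⟩
      k ^ n * ΣX k 2 (λ σ → ΣX N k (λ x → inside-σ σ x * commonNbrs σ ^ n)) ≡⟨ cong (k ^ n *_) (ΣX-cong k 2 step2) ⟩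
      k ^ n * ΣX k 2 (λ σ → ΠF N (λ u → if adj G u v then size-σ σ else k) * commonNbrs σ ^ n) ≡⟨ ΣX-*ˡ k 2 (k ^ n) _ ⟩
      ΣX k 2 (λ σ → k ^ n * (ΠF N (λ u → if adj G u v then size-σ σ else k) * commonNbrs σ ^ n)) ≤⟨ ΣX-mono k 2 bound-per-σ ⟩
      ΣX k 2 (λ σ → k ^ N * e ^ n) ≡⟨ ΣX-const k 2 _ ⟩
      2 ^ k * (k ^ N * e ^ n) ≡⟨ lem (2 ^ k) (k ^ N) (e ^ n) ⟩
      k ^ N * Q ∎
      where
      open ≤-Reasoning
      lem : ∀ a b c → a * (b * c) ≡ b * (a * c)
      lem = solve-∀
      step1 : ΣX N k (λ x → star v x ^ n) ≡ ΣX k 2 (λ σ → ΣX N k (λ x → ind (matches σ x) * starCount x ^ n))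
      step1 = begin-equality
        ΣX N k (λ x → star v x ^ n) ≡⟨ ΣX-cong N k (λ x → trans (cong (_^ n) (star≡starCount x)) (sym (trans (cong (_* starCount x ^ n) (unique-match x)) (*-identityˡ _)))) ⟩
        ΣX N k (λ x → ΣX k 2 (λ σ → ind (matches σ x)) * starCount x ^ n) ≡⟨ ΣX-cong N k (λ x → sumL-*ʳ (allFuns k 2) _ (starCount x ^ n)) ⟩
        ΣX N k (λ x → ΣX k 2 (λ σ → ind (matches σ x) * starCount x ^ n)) ≡⟨ sumL-swap (allFuns N k) (allFuns k 2) _ ⟩
        ΣX k 2 (λ σ → ΣX N k (λ x → ind (matches σ x) * starCount x ^ n)) ∎
      step2 : ∀ σ → ΣX N k (λ x → inside-σ σ x * commonNbrs σ ^ n) ≡ ΠF N (λ u → if adj G u v then size-σ σ else k) * commonNbrs σ ^ n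
      step2 σ = trans (sym (sumL-*ʳ (allFuns N k) (inside-σ σ) (commonNbrs σ ^ n)))
                  (cong (_* commonNbrs σ ^ n) (trans (prodSum N k (λ u a → ind (not (adj G u v) ∨ isOne (σ a)))) (ΠF-cong N (ΣF-inside-σ σ))))

  mask-black-white : ∀ v → col v ≡ true → ∀ j → (not (col j) ∧ dep v j) ≡ adj G v j
  mask-black-white v cv j = aux (col j) refl
    where
    aux : ∀ b → col j ≡ b → (not (col j) ∧ dep v j) ≡ adj G v j
    aux true cj = trans (cong (λ t → not t ∧ dep v j) cj) (sym (noEdgeSameColour v j (trans cv (sym cj))))
    aux false cj = trans (cong (λ t → not t ∧ dep v j) cj)
                     (trans (cong (λ t → t ∧ (eqᵇ v j ∨ adj G j v)) cv)
                       (trans (cong (_∨ adj G j v) fvj) (Graph.sym G j v)))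
      where
      fvj : eqᵇ v j ≡ false
      fvj with eqᵇ v j in e
      ... | false = refl
      ... | true with eqᵇ-sound v j e
      ...   | refl with trans (sym cj) cv
      ...     | ()

  F2-white : ∀ v → col v ≡ true → F2 v x₀ ≤ Q
  F2-white v cv = *-cancelˡ-≤ (k ^ N) {{m^n≢0 k N}} (begin
      k ^ N * F2 v x₀ ≡⟨ sym (ΣX-constantFun (F2 v) (F2-ext v) (F2-indep v)) ⟩
      ΣX N k (F2 v) ≡⟨ ΣX-sumOutAll L _ (F1ⁿ v) (F1ⁿ-ext v) ⟩
      k ^ c3 * ΣX N k (F1ⁿ v) ≡⟨ cong₂ (λ a b → k ^ a * b) c3≡ (ΣX-cong N k (λ x → cong (λ t → (if t then star v x else 1) ^ n) cv)) ⟩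
      k ^ n * ΣX N k (λ x → star v x ^ n) ≤⟨ StarBound.starBound v ⟩
      k ^ N * Q ∎)
    where
    open ≤-Reasoning
    c3 : ℕ
    c3 = sumL L (λ j → ind (not (col j) ∧ dep v j))
    c3≡ : c3 ≡ n
    c3≡ = trans (sumL-L _) (trans (ΣF-cong N (λ j → cong ind (mask-black-white v cv j))) (deg v))

  F2-black : ∀ v → col v ≡ false → F2 v x₀ ≡ 1
  F2-black v cv = trans (sumOutAll-single L _ v (F1ⁿ v) (λ j h → ⊥-elim (false≢true (trans (sym (mF j)) h))) x₀)
                   (trans (cong (λ t → sumOutIter t v (F1ⁿ v) x₀) cnt)
                     (trans (cong (λ t → (if t then star v x₀ else 1) ^ n) cv) (^-zeroˡ n)))
    where
    mF : ∀ j → (not (col j) ∧ dep v j) ≡ false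
    mF j = trans (cong (λ t → not (col j) ∧ (t ∧ (eqᵇ v j ∨ adj G j v))) cv) (∧-zeroʳ _)
    cnt : sumL L (λ j → ind (not (col j) ∧ dep v j)) ≡ 0
    cnt = trans (sumL-L _) (ΣF-zero N _ (λ j → cong ind (mF j)))

  F2-bound : ∀ v → F2 v x₀ ≤ (if col v then Q else 1)
  F2-bound v = aux (col v) refl
    where
    aux : ∀ b → col v ≡ b → F2 v x₀ ≤ (if col v then Q else 1)
    aux true cv = subst (λ t → F2 v x₀ ≤ (if t then Q else 1)) (sym cv) (F2-white v cv)
    aux false cv = subst (λ t → F2 v x₀ ≤ (if t then Q else 1)) (sym cv) (≤-reflexive (F2-black v cv))

  hom^n≤Q^whites : homCount G H ^ n ≤ Q ^ ΣF N (λ v → ind (col v))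
  hom^n≤Q^whites = begin
    T ^ n ≡⟨ cong (_^ n) (sym S2≡hom) ⟩
    S2 x₀ ^ n ≤⟨ phase₂ x₀ ⟩
    ΠF N (λ v → F2 v x₀) ≤⟨ ΠF-mono N F2-bound ⟩
    ΠF N (λ v → if col v then Q else 1) ≡⟨ ΠF-if1 N col Q ⟩
    Q ^ ΣF N (λ v → ind (col v)) ∎
    where open ≤-Reasoning

hom≤k^N : (G H : Graph) → homCount G H ≤ size H ^ size G
hom≤k^N G H = begin
    homCount G H ≡⟨ homCount-eq ⟩
    ΣX N k homℕ ≤⟨ ΣX-mono N k (λ x → subst (_≤ 1) (sym (homℕ-bool x)) (ind≤1 _)) ⟩
    ΣX N k (λ _ → 1) ≡⟨ ΣX-const N k 1 ⟩
    k ^ N * 1 ≡⟨ *-identityʳ _ ⟩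
    k ^ N ∎
  where open HomIndicator G H
        open ≤-Reasoning

pow≤self : ∀ m p → m ≤ 1 → m ^ suc p ≤ m
pow≤self m p m≤1 = begin
    m * m ^ p ≤⟨ *-monoʳ-≤ m (^-monoˡ-≤ p m≤1) ⟩
    m * 1 ^ p ≡⟨ cong (m *_) (^-zeroˡ p) ⟩
    m * 1 ≡⟨ *-identityʳ m ⟩
    m ∎
  where open ≤-Reasoning

upper-empty : ∀ n → 1 ≤ n → (G H : Graph) → size H ≡ 0 → ∀ e →
  homCount G H ^ (2 * n) ≤ e ^ (n * size G) * 2 ^ (size G * size H)
upper-empty n@(suc n₁) _ G H k≡0 e = begin
    T ^ (2 * n) ≤⟨ pow≤self T (n₁ + 1 * n) T≤1 ⟩
    T ≤⟨ T≤0^N ⟩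
    0 ^ N ≤⟨ ^-monoˡ-≤ N z≤n ⟩
    (e ^ n) ^ N ≡⟨ ^-*-assoc e n N ⟩
    e ^ (n * N) ≡⟨ sym (*-identityʳ _) ⟩
    e ^ (n * N) * 2 ^ 0 ≡⟨ cong (λ t → e ^ (n * N) * 2 ^ t) (sym (trans (cong (N *_) k≡0) (*-zeroʳ N))) ⟩
    e ^ (n * N) * 2 ^ (N * size H) ∎
  where
  open ≤-Reasoning
  T N : ℕ
  T = homCount G H
  N = size G
  T≤0^N : T ≤ 0 ^ N
  T≤0^N = subst (λ t → T ≤ t ^ N) k≡0 (hom≤k^N G H)
  T≤1 : T ≤ 1
  T≤1 = ≤-trans T≤0^N (subst (0 ^ N ≤_) (^-zeroˡ N) (^-monoˡ-≤ N z≤n))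

-- Upper bound for nonempty H: apply Upper to the colouring and to its complement and
-- multiply; the two colour classes together contain all N vertices.
upper-nonempty : ∀ n → 1 ≤ n → (G : Graph) → IsSimple G → IsBipartite G → IsRegular n G →
  (H : Graph) → ∀ e → IsEta H e → ∀ k′ → size H ≡ suc k′ →
  homCount G H ^ (2 * n) ≤ e ^ (n * size G) * 2 ^ (size G * size H)
upper-nonempty n n1 G simple (col , bip) reg H e eta k′ hk = begin
    T ^ (2 * n) ≡⟨ cong (T ^_) (cong (n +_) (+-identityʳ n)) ⟩
    T ^ (n + n) ≡⟨ ^-distribˡ-+-* T n n ⟩
    T ^ n * T ^ n ≤⟨ *-mono-≤ (Upper.hom^n≤Q^whites G H col bip simple n n1 reg e eta k′ hk)
                              (Upper.hom^n≤Q^whites G H (λ v → not (col v)) bip′ simple n n1 reg e eta k′ hk) ⟩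
    Q ^ whites * Q ^ blacks ≡⟨ sym (^-distribˡ-+-* Q whites blacks) ⟩
    Q ^ (whites + blacks) ≡⟨ cong (Q ^_) (ΣF-split N col) ⟩
    Q ^ N ≡⟨ ^-distrib-* (2 ^ k) (e ^ n) N ⟩
    (2 ^ k) ^ N * (e ^ n) ^ N ≡⟨ cong₂ _*_ (^-*-assoc 2 k N) (^-*-assoc e n N) ⟩
    2 ^ (k * N) * e ^ (n * N) ≡⟨ *-comm (2 ^ (k * N)) (e ^ (n * N)) ⟩
    e ^ (n * N) * 2 ^ (k * N) ≡⟨ cong (λ t → e ^ (n * N) * 2 ^ t) (*-comm k N) ⟩
    e ^ (n * N) * 2 ^ (N * k) ∎
  where
  open ≤-Reasoning
  T N k Q whites blacks : ℕ
  T = homCount G H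
  N = size G
  k = size H
  Q = 2 ^ k * e ^ n
  whites = ΣF N (λ v → ind (col v))
  blacks = ΣF N (λ v → ind (not (col v)))
  bip′ : ∀ u v → adj G u v ≡ true → not (col u) ≡ not (not (col v))
  bip′ u v a = cong not (bip u v a)

proposition1p3 : (n : ℕ) → 1 ≤ n → (G : Graph) → IsSimple G → IsBipartite G → IsRegular n G →
    (H : Graph) → (e : ℕ) → IsEta H e →
    (e ^ size G ≤ homCount G H ^ 2)
    × (homCount G H ^ (2 * n) ≤ e ^ (n * size G) * 2 ^ (size G * size H))
proposition1p3 n n1 G simple bipartite@(col , bip) reg H e eta =
  Lower.lower G H col bip e eta , upper (size H) refl
  where
  upper : ∀ k → size H ≡ k → homCount G H ^ (2 * n) ≤ e ^ (n * size G) * 2 ^ (size G * size H)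
  upper zero k≡0 = upper-empty n n1 G H k≡0 e
  upper (suc k′) hk = upper-nonempty n n1 G simple bipartite reg H e eta k′ hk
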